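{- For all positive integers $k$ and $t$, \[\Pr_{G\sim G(n,1/2)}\bigl[\theta^t(G)\not\models\mathrm{EA}^t_k\bigr]=\mathrm{negl}(n).\]
   Context: $G(n,1/2)$ is the uniform distribution over graphs on $[n]$. For a graph $G$, $\theta^t(G)$ is the $t$-hypergraph on $V(G)$ in which a set $\{x_1,\dots,x_t\}$ of $t$ distinct vertices is a hyperedge iff the number of vertices $y$ adjacent to every one of $x_1,\dots,x_t$ is odd (i.e. it is defined by the formula $\oplus y\,\bigwedge_{i=1}^t E(y,x_i)$). A $t$-hypergraph satisfies $\mathrm{EA}^t_k$ if for every set $S$ of $k$ vertices and every $T\subseteq\binom{S}{t-1}$ there exists $v\notin S$ such that for every $\{s_1,\dots,s_{t-1}\}\in\binom{S}{t-1}$, $\{s_1,\dots,s_{t-1},v\}$ is a hyperedge iff $\{s_1,\dots,s_{t-1}\}\in T$. $f(n)=\mathrm{negl}(n)$ means for every polynomial $p$, $|f(n)|\le1/p(n)$ for large $n$. -}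

module Defs where

open import Data.Bool using (Bool; true; false; _∧_)
open import Data.Unit using (⊤)
open import Data.Nat using (ℕ; zero; suc; _+_; _*_; _∸_; _%_; _^_; _≤_)
open import Data.Nat.Combinatorics using (_C_)
open import Data.Fin using (Fin; zero; suc)
open import Data.Fin.Subset using (Subset; ∣_∣)
open import Data.Vec using (Vec; []; _∷_; lookup)
open import Data.List using (List; []; _∷_; length; filterᵇ; allFin)
open import Data.List.Relation.Unary.Unique.Propositional using (Unique)
open import Data.List.Membership.Propositional using (_∈_)
open import Data.Product using (_×_; _,_; ∃-syntax)
open import Relation.Binary.PropositionalEquality using (_≡_; _≢_)
open import Relation.Nullary using (¬_)
open import Function.Bundles using (_⇔_)

-- Graph (suc n) = a graph on the last n vertices (suc _) together with the
-- adjacency row of the new vertex 'zero' to them.  This is a bijection with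
-- the set of all graphs on n labelled vertices, so Graph n has exactly
-- 2 ^ (n C 2) elements and G(n,1/2) is the uniform distribution on Graph n.
Graph : ℕ → Set
Graph zero    = ⊤
Graph (suc n) = Graph n × Vec Bool n

adj : ∀ {n} → Graph n → Fin n → Fin n → Bool
adj {suc n} (g , r) zero    zero    = false
adj {suc n} (g , r) zero    (suc j) = lookup r j
adj {suc n} (g , r) (suc i) zero    = lookup r i
adj {suc n} (g , r) (suc i) (suc j) = adj g i j

allᵇ : {A : Set} → (A → Bool) → List A → Bool
allᵇ f []       = true
allᵇ f (x ∷ xs) = f x ∧ allᵇ f xs

commonNbrs : ∀ {n} → Graph n → List (Fin n) → ℕ
commonNbrs {n} G xs = length (filterᵇ (λ y → allᵇ (adj G y) xs) (allFin n))

-- hyperedges of θ^t(G): sets of t distinct vertices with an odd number of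
-- common neighbours (a set is given as a duplicate-free list of its elements)
Hyperedge : ∀ {n} → ℕ → Graph n → List (Fin n) → Set
Hyperedge t G X = Unique X × length X ≡ t × commonNbrs G X % 2 ≡ 1

pick : ∀ {n k} → Vec (Fin n) k → Subset k → List (Fin n)
pick []      []           = []
pick (s ∷ S) (true  ∷ σ)  = s ∷ pick S σ
pick (s ∷ S) (false ∷ σ)  = pick S σ

-- A k-set S of vertices is an injective Vec (Fin n) k;
-- a (t-1)-subset of S is σ : Subset k with ∣ σ ∣ ≡ t ∸ 1; T ⊆ binom(S,t-1)
-- is given by its (decidable) indicator function (values off the
-- (t-1)-subsets are irrelevant).
EA : ∀ {n} → ℕ → ℕ → Graph n → Set
EA {n} t k G =
  (S : Vec (Fin n) k) → (∀ i j → lookup S i ≡ lookup S j → i ≡ j) →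
  (T : Subset k → Bool) →
  ∃[ v ] ((∀ i → lookup S i ≢ v) ×
          (∀ (σ : Subset k) → ∣ σ ∣ ≡ t ∸ 1 →
             Hyperedge t G (v ∷ pick S σ) ⇔ (T σ ≡ true)))

-- polynomials with natural coefficients (constant term first), Horner eval
evalPoly : List ℕ → ℕ → ℕ
evalPoly []       x = 0
evalPoly (c ∷ cs) x = c + x * evalPoly cs x

-- Pr_{G ~ G(n,1/2)}[¬ P G] ≤ 1 / p(n), i.e. #{G | ¬ P G} * p(n) ≤ 2^(n C 2),
-- phrased as: some list of graphs of length L contains every bad graph and
-- L * p(n) ≤ 2^(n C 2).
FailProbAtMost : ∀ n → (Graph n → Set) → ℕ → Set
FailProbAtMost n P pn =
  ∃[ L ] ((∀ (G : Graph n) → ¬ P G → G ∈ L) × length L * pn ≤ 2 ^ (n C 2))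

-- Fix k distinct vertices S and a target τ prescribing, for each (t-1)-subset σ of S, whether
-- σ ∪ {v} should be a hyperedge.  Split the remaining vertices into candidates (lower half) and a
-- witness pool (upper half); a witness for σ is a pool vertex whose neighbourhood in S is exactly σ.
-- If every σ has a witness, toggling the edges between a candidate v and a set of witnesses B shifts
-- the parity pattern of v by the indicator of B, since the witness of σ′ is a common neighbour of σ
-- only when σ′ = σ.  A switching (double counting) argument therefore bounds the proportion of
-- graphs in which no candidate realises τ by (1 - 2^-m)^|U|, where m = C(k, t-1), plus the
-- probability that some σ lacks a witness, which is at most (1 - 2^-k)^|W| per σ by the same
-- argument.  Both decay exponentially in n, and a union bound over the n^k · 2^m pairs (S , τ)
-- beats any polynomial.
module Submission where

open import Defs
open import Algebra.Bundles using (CommutativeRing)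
open import Data.Bool.Base using (Bool; true; false; _∧_; _∨_; not; _xor_; if_then_else_; T)
open import Data.Bool.ListAction using (any)
open import Data.Bool.Properties
  using (not-involutive; not-distribˡ-xor; xor-∧-commutativeRing; xor-comm; xor-same; xor-assoc; xor-identityʳ;
         ∧-assoc; ∧-comm; ∧-identityʳ; ∧-zeroʳ; ∧-distribʳ-xor; ∨-zeroʳ)
open import Data.Empty using (⊥-elim)
open import Data.Fin.Base using (Fin; zero; suc; toℕ)
open import Data.Fin.Subset using (Subset; ∣_∣)
open import Data.List.Base as List using (List; []; _∷_; length; map; _++_; filterᵇ; findᵇ; allFin; cartesianProduct)
open import Data.List.Properties using (length-++; length-map; map-tabulate; length-tabulate)
open import Data.List.Membership.Propositional using (_∈_; _∉_)
open import Data.List.Membership.Propositional.Properties using (∈-filter⁺; ∈-filter⁻; ∈-lookup)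
open import Data.List.Relation.Unary.All as All using (All; []; _∷_)
open import Data.List.Relation.Unary.AllPairs using ([]; _∷_)
open import Data.List.Relation.Unary.Any using (here; there; index)
open import Data.List.Relation.Unary.Any.Properties using (lookup-index)
open import Data.List.Relation.Unary.Unique.Propositional using (Unique)
open import Data.List.Relation.Unary.Unique.Propositional.Properties as Unique using (allFin⁺)
open import Data.Maybe.Base using (Maybe; just; nothing; is-just; maybe)
open import Data.Nat.Base using (ℕ; zero; suc; _+_; _*_; _∸_; _^_; _%_; _/_; _≤_; _<_; _≡ᵇ_; _<ᵇ_; ⌊_/2⌋; z≤n; s≤s)
open import Data.Nat.Combinatorics using (_C_; nC1≡n; nCk+nC[k+1]≡[n+1]C[k+1])
open import Data.Nat.DivMod using (m≡m%n+[m/n]*n; m%n<n; m/n*n≤m; m*n/n≡m; /-monoˡ-≤)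
open import Data.Nat.ListAction using (sum)
open import Data.Nat.Properties
open import Data.Nat.Tactic.RingSolver using (solve-∀)
open import Data.Product.Base using (_×_; _,_; proj₁; proj₂; ∃-syntax)
open import Data.Unit.Base using (⊤; tt)
open import Data.Vec.Base as Vec using (Vec; []; _∷_; lookup; tabulate; zipWith)
open import Data.Vec.Properties using (lookup∘tabulate; tabulate∘lookup; tabulate-cong; lookup-map; lookup-zipWith)
open import Function.Bundles using (_⇔_; mk⇔)
open import Relation.Binary.PropositionalEquality
open import Relation.Nullary using (¬_)
open import Relation.Nullary.Decidable.Core using (T?)
open import Algebra.Properties.CommutativeSemigroup +-commutativeSemigroup
  using () renaming (interchange to +-interchange)
open import Algebra.Properties.CommutativeSemigroup (CommutativeRing.+-commutativeSemigroup xor-∧-commutativeRing)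
  using () renaming (interchange to xor-interchange)

-- Indicators, sums and parity

⟦_⟧ : Bool → ℕ
⟦ true ⟧  = 1
⟦ false ⟧ = 0

⟦∧⟧ : ∀ a b → ⟦ a ∧ b ⟧ ≡ ⟦ a ⟧ * ⟦ b ⟧
⟦∧⟧ true  b = sym (+-identityʳ _)
⟦∧⟧ false b = refl

⟦⟧+⟦not⟧ : ∀ a → ⟦ a ⟧ + ⟦ not a ⟧ ≡ 1
⟦⟧+⟦not⟧ true  = refl
⟦⟧+⟦not⟧ false = refl

⟦⟧≤1 : ∀ a → ⟦ a ⟧ ≤ 1
⟦⟧≤1 true  = s≤s z≤n
⟦⟧≤1 false = z≤n

⟦∨⟧≤ : ∀ a b → ⟦ a ∨ b ⟧ ≤ ⟦ a ⟧ + ⟦ b ⟧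
⟦∨⟧≤ true  b = s≤s z≤n
⟦∨⟧≤ false b = ≤-refl

∧-true : ∀ {a b} → a ∧ b ≡ true → a ≡ true × b ≡ true
∧-true {true} {true} _ = refl , refl

∨-false : ∀ {a b} → a ∨ b ≡ false → a ≡ false × b ≡ false
∨-false {false} {false} _ = refl , refl

∑ : {A : Set} → List A → (A → ℕ) → ℕ
∑ xs f = sum (map f xs)

module _ {A : Set} where

  ∑-cong : ∀ (xs : List A) {f g : A → ℕ} → (∀ x → f x ≡ g x) → ∑ xs f ≡ ∑ xs g
  ∑-cong []       f≗g = refl
  ∑-cong (x ∷ xs) f≗g = cong₂ _+_ (f≗g x) (∑-cong xs f≗g)

  ∑-mono : ∀ (xs : List A) {f g : A → ℕ} → (∀ x → f x ≤ g x) → ∑ xs f ≤ ∑ xs g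
  ∑-mono []       f≤g = z≤n
  ∑-mono (x ∷ xs) f≤g = +-mono-≤ (f≤g x) (∑-mono xs f≤g)

  ∑-+ : ∀ (xs : List A) (f g : A → ℕ) → ∑ xs (λ x → f x + g x) ≡ ∑ xs f + ∑ xs g
  ∑-+ []       f g = refl
  ∑-+ (x ∷ xs) f g =
    trans (cong (f x + g x +_) (∑-+ xs f g)) (+-interchange (f x) (g x) (∑ xs f) (∑ xs g))

  ∑-*ˡ : ∀ (xs : List A) c (f : A → ℕ) → ∑ xs (λ x → c * f x) ≡ c * ∑ xs f
  ∑-*ˡ []       c f = sym (*-zeroʳ c)
  ∑-*ˡ (x ∷ xs) c f = trans (cong (c * f x +_) (∑-*ˡ xs c f)) (sym (*-distribˡ-+ c (f x) _))

  ∑-*ʳ : ∀ (xs : List A) c (f : A → ℕ) → ∑ xs (λ x → f x * c) ≡ ∑ xs f * c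
  ∑-*ʳ []       c f = refl
  ∑-*ʳ (x ∷ xs) c f = trans (cong (f x * c +_) (∑-*ʳ xs c f)) (sym (*-distribʳ-+ c (f x) _))

  ∑-const : ∀ (xs : List A) c → ∑ xs (λ _ → c) ≡ c * length xs
  ∑-const []       c = sym (*-zeroʳ c)
  ∑-const (x ∷ xs) c = trans (cong (c +_) (∑-const xs c)) (sym (*-suc c (length xs)))

  length≡∑1 : ∀ (xs : List A) → length xs ≡ ∑ xs (λ _ → 1)
  length≡∑1 xs = sym (trans (∑-const xs 1) (*-identityˡ _))

  ∑-++ : ∀ (xs ys : List A) (f : A → ℕ) → ∑ (xs ++ ys) f ≡ ∑ xs f + ∑ ys f
  ∑-++ []       ys f = refl
  ∑-++ (x ∷ xs) ys f = trans (cong (f x +_) (∑-++ xs ys f)) (sym (+-assoc (f x) _ _))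

  ∑-map : ∀ {B : Set} (g : B → A) (xs : List B) (f : A → ℕ) → ∑ (map g xs) f ≡ ∑ xs (λ x → f (g x))
  ∑-map g []       f = refl
  ∑-map g (x ∷ xs) f = cong (f (g x) +_) (∑-map g xs f)

  length-filterᵇ : ∀ (p : A → Bool) (xs : List A) → length (filterᵇ p xs) ≡ ∑ xs (λ x → ⟦ p x ⟧)
  length-filterᵇ p []       = refl
  length-filterᵇ p (x ∷ xs) with p x
  ... | true  = cong suc (length-filterᵇ p xs)
  ... | false = length-filterᵇ p xs

∑-comm : ∀ {A B : Set} (xs : List A) (ys : List B) (f : A → B → ℕ) →
         ∑ xs (λ x → ∑ ys (λ y → f x y)) ≡ ∑ ys (λ y → ∑ xs (λ x → f x y))
∑-comm []       ys f = sym (∑-const ys 0)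
∑-comm (x ∷ xs) ys f =
  trans (cong (∑ ys (f x) +_) (∑-comm xs ys f)) (sym (∑-+ ys (f x) (λ y → ∑ xs (λ x → f x y))))

∑-cartesianProduct : ∀ {A B : Set} (xs : List A) (ys : List B) (f : A × B → ℕ) →
                     ∑ (cartesianProduct xs ys) f ≡ ∑ xs (λ x → ∑ ys (λ y → f (x , y)))
∑-cartesianProduct []       ys f = refl
∑-cartesianProduct (x ∷ xs) ys f = begin
  ∑ (map (x ,_) ys ++ cartesianProduct xs ys) f              ≡⟨ ∑-++ (map (x ,_) ys) _ f ⟩
  ∑ (map (x ,_) ys) f + ∑ (cartesianProduct xs ys) f         ≡⟨ cong₂ _+_ (∑-map (x ,_) ys f) (∑-cartesianProduct xs ys f) ⟩
  ∑ ys (λ y → f (x , y)) + ∑ xs (λ x → ∑ ys (λ y → f (x , y))) ∎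
  where open ≡-Reasoning

length-cartesianProduct : ∀ {A B : Set} (xs : List A) (ys : List B) →
                          length (cartesianProduct xs ys) ≡ length xs * length ys
length-cartesianProduct []       ys = refl
length-cartesianProduct (x ∷ xs) ys =
  trans (length-++ (map (x ,_) ys)) (cong₂ _+_ (length-map (x ,_) ys) (length-cartesianProduct xs ys))

isOdd : ℕ → Bool
isOdd zero    = false
isOdd (suc n) = not (isOdd n)

isOdd-+ : ∀ a b → isOdd (a + b) ≡ isOdd a xor isOdd b
isOdd-+ zero    b = refl
isOdd-+ (suc a) b = trans (cong not (isOdd-+ a b)) (not-distribˡ-xor (isOdd a) (isOdd b))

isOdd-⟦⟧ : ∀ b → isOdd ⟦ b ⟧ ≡ b
isOdd-⟦⟧ true  = refl
isOdd-⟦⟧ false = refl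

%2≡⟦isOdd⟧ : ∀ n → n % 2 ≡ ⟦ isOdd n ⟧
%2≡⟦isOdd⟧ zero          = refl
%2≡⟦isOdd⟧ (suc zero)    = refl
%2≡⟦isOdd⟧ (suc (suc n)) = trans (%2≡⟦isOdd⟧ n) (cong ⟦_⟧ (sym (not-involutive (isOdd n))))

isOdd⇒%2≡1 : ∀ n → isOdd n ≡ true → n % 2 ≡ 1
isOdd⇒%2≡1 n odd = trans (%2≡⟦isOdd⟧ n) (cong ⟦_⟧ odd)

%2≡1⇒isOdd : ∀ n → n % 2 ≡ 1 → isOdd n ≡ true
%2≡1⇒isOdd n n%2≡1 with isOdd n | %2≡⟦isOdd⟧ n
... | true  | _    = refl
... | false | n%2≡0 with trans (sym n%2≡0) n%2≡1
...   | ()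

module _ {A : Set} where

  isOdd-∑ : ∀ (xs : List A) (p : A → Bool) (x : A) →
            isOdd (⟦ p x ⟧ + ∑ xs (λ y → ⟦ p y ⟧)) ≡ p x xor isOdd (∑ xs (λ y → ⟦ p y ⟧))
  isOdd-∑ xs p x = trans (isOdd-+ ⟦ p x ⟧ _) (cong (_xor _) (isOdd-⟦⟧ (p x)))

  isOdd-∑-xor : ∀ (xs : List A) (p q : A → Bool) →
                isOdd (∑ xs (λ x → ⟦ p x xor q x ⟧)) ≡
                isOdd (∑ xs (λ x → ⟦ p x ⟧)) xor isOdd (∑ xs (λ x → ⟦ q x ⟧))
  isOdd-∑-xor []       p q = refl
  isOdd-∑-xor (x ∷ xs) p q = begin
    isOdd (⟦ p x xor q x ⟧ + ∑ xs (λ x → ⟦ p x xor q x ⟧))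
      ≡⟨ isOdd-∑ xs (λ y → p y xor q y) x ⟩
    (p x xor q x) xor isOdd (∑ xs (λ x → ⟦ p x xor q x ⟧))
      ≡⟨ cong ((p x xor q x) xor_) (isOdd-∑-xor xs p q) ⟩
    (p x xor q x) xor (isOdd (∑ xs (λ x → ⟦ p x ⟧)) xor isOdd (∑ xs (λ x → ⟦ q x ⟧)))
      ≡⟨ xor-interchange (p x) (q x) _ _ ⟩
    (p x xor isOdd (∑ xs (λ x → ⟦ p x ⟧))) xor (q x xor isOdd (∑ xs (λ x → ⟦ q x ⟧)))
      ≡⟨ sym (cong₂ _xor_ (isOdd-∑ xs p x) (isOdd-∑ xs q x)) ⟩
    isOdd (∑ (x ∷ xs) (λ x → ⟦ p x ⟧)) xor isOdd (∑ (x ∷ xs) (λ x → ⟦ q x ⟧)) ∎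
    where open ≡-Reasoning

  isOdd-∑-isOdd : ∀ (xs : List A) (f : A → ℕ) → isOdd (∑ xs (λ x → ⟦ isOdd (f x) ⟧)) ≡ isOdd (∑ xs f)
  isOdd-∑-isOdd []       f = refl
  isOdd-∑-isOdd (x ∷ xs) f = trans (isOdd-∑ xs (λ y → isOdd (f y)) x)
    (trans (cong (isOdd (f x) xor_) (isOdd-∑-isOdd xs f)) (sym (isOdd-+ (f x) _)))

  ∧-isOdd-∑ : ∀ (xs : List A) a (p : A → Bool) →
              a ∧ isOdd (∑ xs (λ x → ⟦ p x ⟧)) ≡ isOdd (∑ xs (λ x → ⟦ a ∧ p x ⟧))
  ∧-isOdd-∑ xs true  p = refl
  ∧-isOdd-∑ xs false p = sym (cong isOdd (∑-const xs 0))

-- Enumerations of finite types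

record Enumeration (A : Set) : Set where
  field
    elements : List A
    _==_     : A → A → Bool
    ==⇒≡     : ∀ {x y} → x == y ≡ true → x ≡ y
    ==-refl  : ∀ x → x == x ≡ true
    ∑-==     : ∀ z → ∑ elements (λ x → ⟦ x == z ⟧) ≡ 1

  ==-false : ∀ {x y} → x ≢ y → x == y ≡ false
  ==-false {x} {y} x≢y with x == y in eq
  ... | true  = ⊥-elim (x≢y (==⇒≡ eq))
  ... | false = refl

  ≡⇒== : ∀ {x y} → x ≡ y → x == y ≡ true
  ≡⇒== {x} refl = ==-refl x

  ==-≡ : ∀ {x y u v} → (x ≡ y → u ≡ v) → (u ≡ v → x ≡ y) → x == y ≡ u == v
  ==-≡ {x} {y} {u} {v} to from with x == y in eq₁ | u == v in eq₂
  ... | true  | true  = refl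
  ... | false | false = refl
  ... | true  | false = trans (sym (≡⇒== (to (==⇒≡ eq₁)))) eq₂
  ... | false | true  = trans (sym eq₁) (≡⇒== (from (==⇒≡ eq₂)))

  ∑-Kronecker : ∀ z (f : A → ℕ) → ∑ elements (λ x → ⟦ x == z ⟧ * f x) ≡ f z
  ∑-Kronecker z f = begin
    ∑ elements (λ x → ⟦ x == z ⟧ * f x) ≡⟨ ∑-cong elements pointwise ⟩
    ∑ elements (λ x → ⟦ x == z ⟧ * f z) ≡⟨ ∑-*ʳ elements (f z) _ ⟩
    ∑ elements (λ x → ⟦ x == z ⟧) * f z ≡⟨ cong (_* f z) (∑-== z) ⟩
    1 * f z                             ≡⟨ *-identityˡ (f z) ⟩
    f z                                 ∎
    where
    open ≡-Reasoning
    pointwise : ∀ x → ⟦ x == z ⟧ * f x ≡ ⟦ x == z ⟧ * f z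
    pointwise x with x == z in eq
    ... | true  = cong (λ y → 1 * f y) (==⇒≡ eq)
    ... | false = refl

  ∑-involution : (φ : A → A) → (∀ x → φ (φ x) ≡ x) → (h : A → ℕ) →
                 ∑ elements (λ x → h (φ x)) ≡ ∑ elements h
  ∑-involution φ φ∘φ≗id h = begin
    ∑ elements (λ x → h (φ x))
      ≡⟨ ∑-cong elements (λ x → sym (∑-Kronecker (φ x) h)) ⟩
    ∑ elements (λ x → ∑ elements (λ z → ⟦ z == φ x ⟧ * h z))
      ≡⟨ ∑-comm elements elements _ ⟩
    ∑ elements (λ z → ∑ elements (λ x → ⟦ z == φ x ⟧ * h z))
      ≡⟨ ∑-cong elements (λ z → trans (∑-*ʳ elements (h z) _) (cong (_* h z) (count z))) ⟩
    ∑ elements (λ z → 1 * h z)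
      ≡⟨ ∑-cong elements (λ z → *-identityˡ (h z)) ⟩
    ∑ elements h ∎
    where
    open ≡-Reasoning
    swap : ∀ z x → z == φ x ≡ x == φ z
    swap z x = ==-≡ (λ z≡φx → trans (sym (φ∘φ≗id x)) (cong φ (sym z≡φx)))
                    (λ x≡φz → trans (sym (φ∘φ≗id z)) (cong φ (sym x≡φz)))
    count : ∀ z → ∑ elements (λ x → ⟦ z == φ x ⟧) ≡ 1
    count z = trans (∑-cong elements (λ x → cong ⟦_⟧ (swap z x))) (∑-== (φ z))

  ∈-elements : ∀ z → z ∈ elements
  ∈-elements z = ∈-from-count elements (λ ∑≡0 → 1≢0 (trans (sym (∑-== z)) ∑≡0))
    where
    1≢0 : 1 ≢ 0
    1≢0 ()
    ∈-from-count : ∀ xs → ∑ xs (λ x → ⟦ x == z ⟧) ≢ 0 → z ∈ xs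
    ∈-from-count []       ∑≢0 = ⊥-elim (∑≢0 refl)
    ∈-from-count (x ∷ xs) ∑≢0 with x == z in eq
    ... | true  = here (sym (==⇒≡ eq))
    ... | false = there (∈-from-count xs ∑≢0)

  ∈⇒1≤∑-== : ∀ {z} xs → z ∈ xs → 1 ≤ ∑ xs (λ x → ⟦ x == z ⟧)
  ∈⇒1≤∑-== (x ∷ xs) (here refl) = ≤-trans (≤-reflexive (cong ⟦_⟧ (sym (==-refl x)))) (m≤m+n _ _)
  ∈⇒1≤∑-== (x ∷ xs) (there z∈xs) = ≤-trans (∈⇒1≤∑-== xs z∈xs) (m≤n+m _ _)

  elements-unique : Unique elements
  elements-unique = unique elements (λ z → ≤-reflexive (∑-== z))
    where
    unique : ∀ xs → (∀ z → ∑ xs (λ x → ⟦ x == z ⟧) ≤ 1) → Unique xs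
    unique []       _   = []
    unique (x ∷ xs) ≤1 = All.tabulate x∉xs ∷ unique xs (λ z → ≤-trans (m≤n+m _ _) (≤1 z))
      where
      x∉xs : ∀ {y} → y ∈ xs → x ≢ y
      x∉xs y∈xs refl = <⇒≱ twice (≤1 x)
        where
        twice : 1 < ⟦ x == x ⟧ + ∑ xs (λ x′ → ⟦ x′ == x ⟧)
        twice = subst (λ b → 1 < ⟦ b ⟧ + ∑ xs (λ x′ → ⟦ x′ == x ⟧)) (sym (==-refl x)) (s≤s (∈⇒1≤∑-== xs y∈xs))

open Enumeration

enumBool : Enumeration Bool
enumBool .elements = true ∷ false ∷ []
enumBool ._==_ true  true  = true
enumBool ._==_ false false = true
enumBool ._==_ _     _     = false
enumBool .==⇒≡ {true}  {true}  _ = refl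
enumBool .==⇒≡ {false} {false} _ = refl
enumBool .==-refl true  = refl
enumBool .==-refl false = refl
enumBool .∑-== true  = refl
enumBool .∑-== false = refl

enum⊤ : Enumeration ⊤
enum⊤ .elements = tt ∷ []
enum⊤ ._==_ _ _ = true
enum⊤ .==⇒≡ _ = refl
enum⊤ .==-refl _ = refl
enum⊤ .∑-== _ = refl

enum× : ∀ {A B : Set} → Enumeration A → Enumeration B → Enumeration (A × B)
enum× EA EB .elements = cartesianProduct (elements EA) (elements EB)
enum× EA EB ._==_ (a , b) (a′ , b′) = _==_ EA a a′ ∧ _==_ EB b b′
enum× EA EB .==⇒≡ eq = cong₂ _,_ (==⇒≡ EA (proj₁ (∧-true eq))) (==⇒≡ EB (proj₂ (∧-true eq)))
enum× EA EB .==-refl (a , b) = cong₂ _∧_ (==-refl EA a) (==-refl EB b)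
enum× EA EB .∑-== (a′ , b′) = begin
  ∑ (cartesianProduct (elements EA) (elements EB)) (λ (a , b) → ⟦ _==_ EA a a′ ∧ _==_ EB b b′ ⟧)
    ≡⟨ ∑-cartesianProduct (elements EA) (elements EB) _ ⟩
  ∑ (elements EA) (λ a → ∑ (elements EB) (λ b → ⟦ _==_ EA a a′ ∧ _==_ EB b b′ ⟧))
    ≡⟨ ∑-cong (elements EA) (λ a → trans (∑-cong (elements EB) (λ b → ⟦∧⟧ (_==_ EA a a′) _))
                                        (∑-*ˡ (elements EB) ⟦ _==_ EA a a′ ⟧ _)) ⟩
  ∑ (elements EA) (λ a → ⟦ _==_ EA a a′ ⟧ * ∑ (elements EB) (λ b → ⟦ _==_ EB b b′ ⟧))
    ≡⟨ ∑-Kronecker EA a′ (λ _ → ∑ (elements EB) (λ b → ⟦ _==_ EB b b′ ⟧)) ⟩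
  ∑ (elements EB) (λ b → ⟦ _==_ EB b b′ ⟧)
    ≡⟨ ∑-== EB b′ ⟩
  1 ∎
  where open ≡-Reasoning

enumVec : ∀ {A : Set} → Enumeration A → ∀ n → Enumeration (Vec A n)
enumVec E zero .elements = [] ∷ []
enumVec E zero ._==_ _ _ = true
enumVec E zero .==⇒≡ {[]} {[]} _ = refl
enumVec E zero .==-refl _ = refl
enumVec E zero .∑-== [] = refl
enumVec E (suc n) .elements = map (λ (a , v) → a ∷ v) (elements (enum× E (enumVec E n)))
enumVec E (suc n) ._==_ (a ∷ v) (b ∷ w) = _==_ (enum× E (enumVec E n)) (a , v) (b , w)
enumVec E (suc n) .==⇒≡ {a ∷ v} {b ∷ w} eq = cong (λ (a , v) → a ∷ v) (==⇒≡ (enum× E (enumVec E n)) eq)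
enumVec E (suc n) .==-refl (a ∷ v) = ==-refl (enum× E (enumVec E n)) (a , v)
enumVec E (suc n) .∑-== (a ∷ v) =
  trans (∑-map _ (elements (enum× E (enumVec E n))) _) (∑-== (enum× E (enumVec E n)) (a , v))

length-enumVec : ∀ {A : Set} (E : Enumeration A) n → length (elements (enumVec E n)) ≡ length (elements E) ^ n
length-enumVec E zero    = refl
length-enumVec E (suc n) = begin
  length (map _ (cartesianProduct (elements E) (elements (enumVec E n))))
    ≡⟨ length-map _ (cartesianProduct (elements E) _) ⟩
  length (cartesianProduct (elements E) (elements (enumVec E n)))
    ≡⟨ length-cartesianProduct (elements E) _ ⟩
  length (elements E) * length (elements (enumVec E n))
    ≡⟨ cong (length (elements E) *_) (length-enumVec E n) ⟩
  length (elements E) * length (elements E) ^ n ∎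
  where open ≡-Reasoning

_==ᶠ_ : ∀ {n} → Fin n → Fin n → Bool
zero  ==ᶠ zero  = true
zero  ==ᶠ suc _ = false
suc _ ==ᶠ zero  = false
suc i ==ᶠ suc j = i ==ᶠ j

∑-allFin-suc : ∀ n (f : Fin (suc n) → ℕ) → ∑ (allFin (suc n)) f ≡ f zero + ∑ (allFin n) (λ i → f (suc i))
∑-allFin-suc n f =
  cong (f zero +_) (trans (cong sum (map-tabulate suc f)) (sym (cong sum (map-tabulate (λ i → i) (λ i → f (suc i))))))

==ᶠ⇒≡ : ∀ {n} {i j : Fin n} → i ==ᶠ j ≡ true → i ≡ j
==ᶠ⇒≡ {i = zero}  {zero}  _  = refl
==ᶠ⇒≡ {i = suc i} {suc j} eq = cong suc (==ᶠ⇒≡ eq)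

==ᶠ-refl : ∀ {n} (i : Fin n) → i ==ᶠ i ≡ true
==ᶠ-refl zero    = refl
==ᶠ-refl (suc i) = ==ᶠ-refl i

==ᶠ-sym : ∀ {n} (i j : Fin n) → i ==ᶠ j ≡ j ==ᶠ i
==ᶠ-sym zero    zero    = refl
==ᶠ-sym zero    (suc j) = refl
==ᶠ-sym (suc i) zero    = refl
==ᶠ-sym (suc i) (suc j) = ==ᶠ-sym i j

enumFin : ∀ n → Enumeration (Fin n)
enumFin n .elements = allFin n
enumFin n ._==_ = _==ᶠ_
enumFin n .==⇒≡ = ==ᶠ⇒≡
enumFin n .==-refl = ==ᶠ-refl
enumFin n .∑-== = once
  where
  once : ∀ {m} (j : Fin m) → ∑ (allFin m) (λ i → ⟦ i ==ᶠ j ⟧) ≡ 1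
  once {suc m} zero    = trans (∑-allFin-suc m (λ i → ⟦ i ==ᶠ zero ⟧)) (cong suc (∑-const (allFin m) 0))
  once {suc m} (suc j) = trans (∑-allFin-suc m (λ i → ⟦ i ==ᶠ suc j ⟧)) (once j)

enumGraph : ∀ n → Enumeration (Graph n)
enumGraph zero    = enum⊤
enumGraph (suc n) = enum× (enumGraph n) (enumVec enumBool n)

suc-C2 : ∀ n → suc n C 2 ≡ n + n C 2
suc-C2 n = trans (sym (nCk+nC[k+1]≡[n+1]C[k+1] n 1)) (cong (_+ n C 2) (nC1≡n n))

length-enumGraph : ∀ n → length (elements (enumGraph n)) ≡ 2 ^ (n C 2)
length-enumGraph zero    = refl
length-enumGraph (suc n) = begin
  length (cartesianProduct (elements (enumGraph n)) (elements (enumVec enumBool n)))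
    ≡⟨ length-cartesianProduct (elements (enumGraph n)) _ ⟩
  length (elements (enumGraph n)) * length (elements (enumVec enumBool n))
    ≡⟨ cong₂ _*_ (length-enumGraph n) (length-enumVec enumBool n) ⟩
  2 ^ (n C 2) * 2 ^ n
    ≡⟨ sym (^-distribˡ-+-* 2 (n C 2) n) ⟩
  2 ^ (n C 2 + n)
    ≡⟨ cong (2 ^_) (trans (+-comm (n C 2) n) (sym (suc-C2 n))) ⟩
  2 ^ (suc n C 2) ∎
  where open ≡-Reasoning

-- Asymptotics

1≤[1+x]^n : ∀ x n → 1 ≤ suc x ^ n
1≤[1+x]^n x n = m^n>0 (suc x) n

1+[2^m∸1]≡2^m : ∀ m → suc (2 ^ m ∸ 1) ≡ 2 ^ m
1+[2^m∸1]≡2^m m = m+[n∸m]≡n (1≤[1+x]^n 1 m)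

*-cancelʳ-≤′ : ∀ a b c → 1 ≤ c → a * c ≤ b * c → a ≤ b
*-cancelʳ-≤′ a b (suc c) _ = *-cancelʳ-≤ a b (suc c)

[m*n]^k≡m^k*n^k : ∀ m n k → (m * n) ^ k ≡ m ^ k * n ^ k
[m*n]^k≡m^k*n^k m n zero    = refl
[m*n]^k≡m^k*n^k m n (suc k) = trans (cong (m * n *_) ([m*n]^k≡m^k*n^k m n k)) (interchange m n (m ^ k) (n ^ k))
  where
  interchange : ∀ a b c d → a * b * (c * d) ≡ a * c * (b * d)
  interchange = solve-∀

bernoulli : ∀ r h → r ^ h * (r + h) ≤ suc r ^ h * r
bernoulli r zero    = ≤-reflexive (trans (*-identityˡ (r + 0)) (trans (+-identityʳ r) (sym (*-identityˡ r))))
bernoulli r (suc h) = begin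
  r * r ^ h * (r + suc h)              ≡⟨ expand r (r ^ h) h ⟩
  r * (r ^ h * (r + h)) + r * r ^ h    ≤⟨ +-mono-≤ (*-monoʳ-≤ r (bernoulli r h)) (*-monoʳ-≤ r (^-monoˡ-≤ h (n≤1+n r))) ⟩
  r * (suc r ^ h * r) + r * suc r ^ h  ≡⟨ collect r (suc r ^ h) ⟩
  suc r * suc r ^ h * r                ∎
  where
  open ≤-Reasoning
  expand : ∀ x p y → x * p * (x + suc y) ≡ x * (p * (x + y)) + x * p
  expand = solve-∀
  collect : ∀ x q → x * (q * x) + x * q ≡ suc x * q * x
  collect = solve-∀

2*r^r≤[1+r]^r : ∀ r → 2 * suc r ^ suc r ≤ suc (suc r) ^ suc r
2*r^r≤[1+r]^r r = *-cancelʳ-≤′ _ _ (suc r) (s≤s z≤n)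
  (≤-trans (≤-reflexive (double (suc r ^ suc r) (suc r))) (bernoulli (suc r) (suc r)))
  where
  double : ∀ p x → 2 * p * x ≡ p * (x + x)
  double = solve-∀

-- From (1 + 1/r)^r ≥ 2.
2^j*r^h≤[1+r]^h : ∀ r j h → suc r * j ≤ h → 2 ^ j * suc r ^ h ≤ suc (suc r) ^ h
2^j*r^h≤[1+r]^h r j h rj≤h = begin
  2 ^ j * r′ ^ h                              ≡⟨ cong (λ x → 2 ^ j * r′ ^ x) h≡ ⟩
  2 ^ j * r′ ^ (r′ * j + d)                   ≡⟨ cong (2 ^ j *_) (^-distribˡ-+-* r′ (r′ * j) d) ⟩
  2 ^ j * (r′ ^ (r′ * j) * r′ ^ d)            ≡⟨ sym (*-assoc (2 ^ j) _ _) ⟩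
  2 ^ j * r′ ^ (r′ * j) * r′ ^ d              ≡⟨ cong (λ x → 2 ^ j * x * r′ ^ d) (sym (^-*-assoc r′ r′ j)) ⟩
  2 ^ j * (r′ ^ r′) ^ j * r′ ^ d              ≡⟨ cong (_* r′ ^ d) (sym ([m*n]^k≡m^k*n^k 2 (r′ ^ r′) j)) ⟩
  (2 * r′ ^ r′) ^ j * r′ ^ d                  ≤⟨ *-mono-≤ (^-monoˡ-≤ j (2*r^r≤[1+r]^r r)) (^-monoˡ-≤ d (n≤1+n r′)) ⟩
  (suc r′ ^ r′) ^ j * suc r′ ^ d              ≡⟨ cong (_* suc r′ ^ d) (^-*-assoc (suc r′) r′ j) ⟩
  suc r′ ^ (r′ * j) * suc r′ ^ d              ≡⟨ sym (^-distribˡ-+-* (suc r′) (r′ * j) d) ⟩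
  suc r′ ^ (r′ * j + d)                       ≡⟨ cong (suc r′ ^_) (sym h≡) ⟩
  suc r′ ^ h                                  ∎
  where
  open ≤-Reasoning
  r′ = suc r
  d = h ∸ r′ * j
  h≡ : h ≡ r′ * j + d
  h≡ = sym (m+[n∸m]≡n rj≤h)

⌊n/2⌋+⌊n/2⌋≤n : ∀ n → ⌊ n /2⌋ + ⌊ n /2⌋ ≤ n
⌊n/2⌋+⌊n/2⌋≤n zero          = z≤n
⌊n/2⌋+⌊n/2⌋≤n (suc zero)    = z≤n
⌊n/2⌋+⌊n/2⌋≤n (suc (suc n)) = s≤s (≤-trans (≤-reflexive (+-suc ⌊ n /2⌋ ⌊ n /2⌋)) (s≤s (⌊n/2⌋+⌊n/2⌋≤n n)))

n≤1+⌊n/2⌋+⌊n/2⌋ : ∀ n → n ≤ suc (⌊ n /2⌋ + ⌊ n /2⌋)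
n≤1+⌊n/2⌋+⌊n/2⌋ zero          = z≤n
n≤1+⌊n/2⌋+⌊n/2⌋ (suc zero)    = s≤s z≤n
n≤1+⌊n/2⌋+⌊n/2⌋ (suc (suc n)) = s≤s (≤-trans (s≤s (n≤1+⌊n/2⌋+⌊n/2⌋ n)) (≤-reflexive (cong suc (sym (+-suc ⌊ n /2⌋ ⌊ n /2⌋)))))

m+m≤n⇒m≤⌊n/2⌋ : ∀ {m n} → m + m ≤ n → m ≤ ⌊ n /2⌋
m+m≤n⇒m≤⌊n/2⌋ {m} m+m≤n = subst (_≤ _) (sym (n≡⌊n+n/2⌋ m)) (⌊n/2⌋-mono m+m≤n)

n<2^n : ∀ n → n < 2 ^ n
n<2^n zero    = s≤s z≤n
n<2^n (suc n) = begin-strict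
  suc n            <⟨ s≤s (n<2^n n) ⟩
  suc (2 ^ n)      ≤⟨ +-monoˡ-≤ (2 ^ n) (1≤[1+x]^n 1 n) ⟩
  2 ^ n + 2 ^ n    ≡⟨ cong (2 ^ n +_) (sym (+-identityʳ (2 ^ n))) ⟩
  2 * 2 ^ n        ∎
  where open ≤-Reasoning

polynomial≤exponential : ∀ e A → ∃[ J ] ∀ j → J ≤ j → A * suc j ^ e ≤ 2 ^ j
polynomial≤exponential zero    A = A , λ j A≤j → ≤-trans (≤-reflexive (*-identityʳ A)) (≤-trans A≤j (<⇒≤ (n<2^n j)))
polynomial≤exponential (suc e) A with polynomial≤exponential e (A * 2 ^ suc e)
... | J , bound = J + J , λ j J+J≤j → let i = ⌊ j /2⌋ in begin
  A * suc j ^ suc e                     ≤⟨ *-monoʳ-≤ A (^-monoˡ-≤ (suc e) (≤-trans (s≤s (n≤1+⌊n/2⌋+⌊n/2⌋ j)) (≤-reflexive (double i)))) ⟩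
  A * (2 * suc i) ^ suc e               ≡⟨ cong (A *_) ([m*n]^k≡m^k*n^k 2 (suc i) (suc e)) ⟩
  A * (2 ^ suc e * (suc i * suc i ^ e)) ≡⟨ rearrange A (2 ^ suc e) (suc i) (suc i ^ e) ⟩
  suc i * (A * 2 ^ suc e * suc i ^ e)   ≤⟨ *-mono-≤ (n<2^n i) (bound i (m+m≤n⇒m≤⌊n/2⌋ J+J≤j)) ⟩
  2 ^ i * 2 ^ i                         ≡⟨ sym (^-distribˡ-+-* 2 i i) ⟩
  2 ^ (i + i)                           ≤⟨ ^-monoʳ-≤ 2 (⌊n/2⌋+⌊n/2⌋≤n j) ⟩
  2 ^ j                                 ∎
  where
  open ≤-Reasoning
  double : ∀ x → suc (suc (x + x)) ≡ 2 * suc x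
  double = solve-∀
  rearrange : ∀ a t s p → a * (t * (s * p)) ≡ s * (a * t * p)
  rearrange = solve-∀

polynomial*r^h≤[1+r]^h : ∀ r e A → ∃[ H ] ∀ h → H ≤ h → A * suc h ^ e * suc r ^ h ≤ suc (suc r) ^ h
polynomial*r^h≤[1+r]^h r e A with polynomial≤exponential e (A * suc r ^ e)
... | J , bound = suc r * J , λ h rJ≤h → let j = h / suc r in begin
  A * suc h ^ e * suc r ^ h                 ≤⟨ *-monoˡ-≤ (suc r ^ h) (*-monoʳ-≤ A (^-monoˡ-≤ e (h<r*[1+j] h))) ⟩
  A * (suc r * suc j) ^ e * suc r ^ h       ≡⟨ cong (λ x → A * x * suc r ^ h) ([m*n]^k≡m^k*n^k (suc r) (suc j) e) ⟩
  A * (suc r ^ e * suc j ^ e) * suc r ^ h   ≡⟨ cong (_* suc r ^ h) (sym (*-assoc A _ _)) ⟩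
  A * suc r ^ e * suc j ^ e * suc r ^ h     ≤⟨ *-monoˡ-≤ (suc r ^ h) (bound j (J≤j h rJ≤h)) ⟩
  2 ^ j * suc r ^ h                         ≤⟨ 2^j*r^h≤[1+r]^h r j h (≤-trans (≤-reflexive (*-comm (suc r) j)) (m/n*n≤m h (suc r))) ⟩
  suc (suc r) ^ h                           ∎
  where
  open ≤-Reasoning
  J≤j : ∀ h → suc r * J ≤ h → J ≤ h / suc r
  J≤j h rJ≤h = ≤-trans (≤-reflexive (sym (m*n/n≡m J (suc r))))
                       (/-monoˡ-≤ (suc r) (≤-trans (≤-reflexive (*-comm J (suc r))) rJ≤h))
  h<r*[1+j] : ∀ h → h < suc r * suc (h / suc r)
  h<r*[1+j] h = begin-strict
    h                                     ≡⟨ m≡m%n+[m/n]*n h (suc r) ⟩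
    h % suc r + h / suc r * suc r         <⟨ +-monoˡ-< _ (m%n<n h (suc r)) ⟩
    suc r + h / suc r * suc r             ≡⟨ cong (suc r +_) (*-comm (h / suc r) (suc r)) ⟩
    suc r + suc r * (h / suc r)           ≡⟨ sym (*-suc (suc r) (h / suc r)) ⟩
    suc r * suc (h / suc r)               ∎

evalPoly≤ : ∀ cs x → evalPoly cs x ≤ sum cs * suc x ^ length cs
evalPoly≤ []       x = z≤n
evalPoly≤ (c ∷ cs) x = begin
  c + x * evalPoly cs x                                          ≤⟨ +-mono-≤ c≤ (*-monoʳ-≤ x (evalPoly≤ cs x)) ⟩
  c * suc x ^ suc (length cs) + x * (sum cs * suc x ^ length cs) ≤⟨ +-monoʳ-≤ (c * suc x ^ suc (length cs)) tail≤ ⟩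
  c * suc x ^ suc (length cs) + sum cs * suc x ^ suc (length cs) ≡⟨ sym (*-distribʳ-+ (suc x ^ suc (length cs)) c (sum cs)) ⟩
  (c + sum cs) * suc x ^ suc (length cs)                         ∎
  where
  open ≤-Reasoning
  c≤ : c ≤ c * suc x ^ suc (length cs)
  c≤ = ≤-trans (≤-reflexive (sym (*-identityʳ c))) (*-monoʳ-≤ c (1≤[1+x]^n x (suc (length cs))))
  tail≤ : x * (sum cs * suc x ^ length cs) ≤ sum cs * suc x ^ suc (length cs)
  tail≤ = ≤-trans (≤-reflexive (swap x (sum cs) _)) (*-monoʳ-≤ (sum cs) (*-monoˡ-≤ (suc x ^ length cs) (n≤1+n x)))
    where
    swap : ∀ a b c → a * (b * c) ≡ b * (a * c)
    swap = solve-∀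

-- X ≤ (r / (1 + r)) ^ w * Y, cleared of denominators.
record RatioBound (X Y r w : ℕ) : Set where
  constructor ratioBound
  field
    cleared : X * suc r ^ w ≤ r ^ w * Y

RatioBound-mono-base : ∀ {X Y a r} w → a ≤ r → RatioBound X Y a w → RatioBound X Y r w
RatioBound-mono-base {X} {Y} {a} {r} w a≤r (ratioBound bound) = ratioBound (*-cancelʳ-≤′ _ _ (suc a ^ w) (1≤[1+x]^n a w) (begin
  X * suc r ^ w * suc a ^ w          ≡⟨ swap X (suc r ^ w) (suc a ^ w) ⟩
  X * suc a ^ w * suc r ^ w          ≤⟨ *-monoˡ-≤ (suc r ^ w) bound ⟩
  a ^ w * Y * suc r ^ w              ≡⟨ trans (swap (a ^ w) Y (suc r ^ w)) (cong (_* Y) (sym ([m*n]^k≡m^k*n^k a (suc r) w))) ⟩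
  (a * suc r) ^ w * Y                ≤⟨ *-monoˡ-≤ Y (^-monoˡ-≤ w a[1+r]≤r[1+a]) ⟩
  (r * suc a) ^ w * Y                ≡⟨ trans (cong (_* Y) ([m*n]^k≡m^k*n^k r (suc a) w)) (swap′ (r ^ w) (suc a ^ w) Y) ⟩
  r ^ w * Y * suc a ^ w              ∎))
  where
  open ≤-Reasoning
  swap : ∀ x p q → x * p * q ≡ x * q * p
  swap = solve-∀
  swap′ : ∀ p q y → p * q * y ≡ p * y * q
  swap′ = solve-∀
  a[1+r]≤r[1+a] : a * suc r ≤ r * suc a
  a[1+r]≤r[1+a] = begin
    a * suc r  ≡⟨ *-suc a r ⟩
    a + a * r  ≤⟨ +-monoˡ-≤ (a * r) a≤r ⟩
    r + a * r  ≡⟨ cong (r +_) (*-comm a r) ⟩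
    r + r * a  ≡⟨ sym (*-suc r a) ⟩
    r * suc a  ∎

RatioBound-antimono-exponent : ∀ {X Y r h w} → h ≤ w → RatioBound X Y r w → RatioBound X Y r h
RatioBound-antimono-exponent {X} {Y} {r} {h} {w} h≤w (ratioBound bound) =
  ratioBound (*-cancelʳ-≤′ _ _ (suc r ^ d) (1≤[1+x]^n r d) (begin
  X * suc r ^ h * suc r ^ d   ≡⟨ trans (*-assoc X _ _) (cong (X *_) (sym (^-distribˡ-+-* (suc r) h d))) ⟩
  X * suc r ^ (h + d)         ≡⟨ cong (λ z → X * suc r ^ z) h+d≡w ⟩
  X * suc r ^ w               ≤⟨ bound ⟩
  r ^ w * Y                   ≡⟨ cong (λ z → r ^ z * Y) (sym h+d≡w) ⟩
  r ^ (h + d) * Y             ≡⟨ trans (cong (_* Y) (^-distribˡ-+-* r h d)) (swap (r ^ h) (r ^ d) Y) ⟩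
  r ^ h * Y * r ^ d           ≤⟨ *-monoʳ-≤ (r ^ h * Y) (^-monoˡ-≤ d (n≤1+n r)) ⟩
  r ^ h * Y * suc r ^ d       ∎))
  where
  open ≤-Reasoning
  d = w ∸ h
  h+d≡w : h + d ≡ w
  h+d≡w = m+[n∸m]≡n h≤w
  swap : ∀ p q y → p * q * y ≡ p * y * q
  swap = solve-∀

RatioBound-+ : ∀ {X Y X′ Y′ r w} → RatioBound X Y r w → RatioBound X′ Y′ r w → RatioBound (X + X′) (Y + Y′) r w
RatioBound-+ {X} {Y} {X′} {Y′} {r} {w} (ratioBound bound) (ratioBound bound′) = ratioBound (begin
  (X + X′) * suc r ^ w               ≡⟨ *-distribʳ-+ (suc r ^ w) X X′ ⟩
  X * suc r ^ w + X′ * suc r ^ w     ≤⟨ +-mono-≤ bound bound′ ⟩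
  r ^ w * Y + r ^ w * Y′             ≡⟨ sym (*-distribˡ-+ (r ^ w) Y Y′) ⟩
  r ^ w * (Y + Y′)                   ∎)
  where open ≤-Reasoning

RatioBound-∑ : ∀ {A : Set} (xs : List A) {f g : A → ℕ} {r w} → (∀ x → RatioBound (f x) (g x) r w) →
               RatioBound (∑ xs f) (∑ xs g) r w
RatioBound-∑ []       _      = ratioBound z≤n
RatioBound-∑ (x ∷ xs) bounds = RatioBound-+ (bounds x) (RatioBound-∑ xs bounds)

RatioBound-mono : ∀ {X X′ Y Y′ r w} → X′ ≤ X → Y ≤ Y′ → RatioBound X Y r w → RatioBound X′ Y′ r w
RatioBound-mono {r = r} {w} X′≤X Y≤Y′ (ratioBound bound) =
  ratioBound (≤-trans (*-monoˡ-≤ (suc r ^ w) X′≤X) (≤-trans bound (*-monoʳ-≤ (r ^ w) Y≤Y′)))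

RatioBound-zero : ∀ {Y r w} → RatioBound 0 Y r w
RatioBound-zero = ratioBound z≤n

RatioBound⇒*≤ : ∀ {X D Z r w} q → RatioBound X (D * Z) r w → D * q * r ^ w ≤ suc r ^ w → X * q ≤ Z
RatioBound⇒*≤ {X} {D} {Z} {r} {w} q (ratioBound bound) small = *-cancelʳ-≤′ _ _ (suc r ^ w) (1≤[1+x]^n r w) (begin
  X * q * suc r ^ w        ≡⟨ swap X q (suc r ^ w) ⟩
  X * suc r ^ w * q        ≤⟨ *-monoˡ-≤ q bound ⟩
  r ^ w * (D * Z) * q      ≡⟨ regroup (r ^ w) D Z q ⟩
  D * q * r ^ w * Z        ≤⟨ *-monoˡ-≤ Z small ⟩
  suc r ^ w * Z            ≡⟨ *-comm (suc r ^ w) Z ⟩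
  Z * suc r ^ w            ∎)
  where
  open ≤-Reasoning
  swap : ∀ x p q → x * p * q ≡ x * q * p
  swap = solve-∀
  regroup : ∀ p d z q → p * (d * z) * q ≡ d * q * p * z
  regroup = solve-∀

-- Both the candidates and the witness pool have at least this many vertices.
halfExponent : ℕ → ℕ → ℕ
halfExponent n k = ⌊ n /2⌋ ∸ k

1+n≤[2+k+k]*[1+halfExponent] : ∀ n k → suc n ≤ (2 + k + k) * suc (halfExponent n k)
1+n≤[2+k+k]*[1+halfExponent] n k = begin
  suc n                                          ≤⟨ s≤s (n≤1+⌊n/2⌋+⌊n/2⌋ n) ⟩
  2 + (⌊ n /2⌋ + ⌊ n /2⌋)                        ≤⟨ +-monoʳ-≤ 2 (+-mono-≤ half≤ half≤) ⟩
  2 + ((k + h) + (k + h))                        ≤⟨ m≤m+n _ ((k + k) * h) ⟩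
  2 + ((k + h) + (k + h)) + (k + k) * h          ≡⟨ factor k h ⟩
  (2 + k + k) * suc h                            ∎
  where
  open ≤-Reasoning
  h = halfExponent n k
  half≤ : ⌊ n /2⌋ ≤ k + h
  half≤ = m≤n+m∸n ⌊ n /2⌋ k
  factor : ∀ k h → 2 + ((k + h) + (k + h)) + (k + k) * h ≡ (2 + k + k) * suc h
  factor = solve-∀

polynomial≤[1+halfExponent]^ : ∀ k D p n →
  n ^ k * D * evalPoly p n ≤ D * sum p * (2 + k + k) ^ (k + length p) * suc (halfExponent n k) ^ (k + length p)
polynomial≤[1+halfExponent]^ k D p n = begin
  n ^ k * D * evalPoly p n
    ≤⟨ *-mono-≤ (*-monoˡ-≤ D (^-monoˡ-≤ k (≤-trans (n≤1+n n) 1+n≤)))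
                (≤-trans (evalPoly≤ p n) (*-monoʳ-≤ (sum p) (^-monoˡ-≤ (length p) 1+n≤))) ⟩
  (c * s) ^ k * D * (sum p * (c * s) ^ length p)
    ≡⟨ cong₂ (λ a b → a * D * (sum p * b)) ([m*n]^k≡m^k*n^k c s k) ([m*n]^k≡m^k*n^k c s (length p)) ⟩
  c ^ k * s ^ k * D * (sum p * (c ^ length p * s ^ length p))
    ≡⟨ regroup (c ^ k) (s ^ k) D (sum p) (c ^ length p) (s ^ length p) ⟩
  D * sum p * (c ^ k * c ^ length p) * (s ^ k * s ^ length p)
    ≡⟨ sym (cong₂ (λ a b → D * sum p * a * b) (^-distribˡ-+-* c k (length p)) (^-distribˡ-+-* s k (length p))) ⟩
  D * sum p * c ^ (k + length p) * s ^ (k + length p) ∎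
  where
  open ≤-Reasoning
  c = 2 + k + k
  s = suc (halfExponent n k)
  1+n≤ : suc n ≤ c * s
  1+n≤ = 1+n≤[2+k+k]*[1+halfExponent] n k
  regroup : ∀ a b x y d f → a * b * x * (y * (d * f)) ≡ x * y * (a * d) * (b * f)
  regroup = solve-∀

polynomial*r^halfExponent≤ : ∀ r k D (p : List ℕ) → ∃[ N ] ∀ n → N ≤ n →
  n ^ k * D * evalPoly p n * suc r ^ halfExponent n k ≤ suc (suc r) ^ halfExponent n k
polynomial*r^halfExponent≤ r k D p with polynomial*r^h≤[1+r]^h r (k + length p) (D * sum p * (2 + k + k) ^ (k + length p))
... | H , bound = (H + k) + (H + k) , λ n N≤n →
  ≤-trans (*-monoˡ-≤ (suc r ^ halfExponent n k) (polynomial≤[1+halfExponent]^ k D p n))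
          (bound (halfExponent n k) (m+n≤o⇒m≤o∸n H (m+m≤n⇒m≤⌊n/2⌋ N≤n)))

-- Switching

allᵇ-cong : ∀ {A : Set} {f g : A → Bool} (xs : List A) → (∀ {x} → x ∈ xs → f x ≡ g x) → allᵇ f xs ≡ allᵇ g xs
allᵇ-cong []       f≗g = refl
allᵇ-cong (x ∷ xs) f≗g = cong₂ _∧_ (f≗g (here refl)) (allᵇ-cong xs (λ x∈xs → f≗g (there x∈xs)))

module Switching {X B : Set} (EX : Enumeration X) (EB : Enumeration B) {K : ℕ}
                 (|B|≡1+K : length (elements EB) ≡ suc K) where

  private
    ∑X : (X → ℕ) → ℕ
    ∑X = ∑ (elements EX)
    ∑B : (B → ℕ) → ℕ
    ∑B = ∑ (elements EB)

  -- Double counting of pairs (x , b): each φ b is a bijection of X preserving g.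
  switching-bound : (φ : B → X → X) → (∀ b x → φ b (φ b x) ≡ x) → (g Q : X → Bool) →
                    (∀ b x → g (φ b x) ≡ g x) →
                    (∀ x → g x ≡ true → ∑B (λ b → ⟦ Q (φ b x) ⟧) ≤ K) →
                    ∑X (λ x → ⟦ g x ∧ Q x ⟧) * suc K ≤ K * ∑X (λ x → ⟦ g x ⟧)
  switching-bound φ φ-invol g Q g-inv few = begin
    ∑X (λ x → ⟦ g x ∧ Q x ⟧) * suc K
      ≡⟨ cong (∑X (λ x → ⟦ g x ∧ Q x ⟧) *_) (sym |B|≡1+K) ⟩
    ∑X (λ x → ⟦ g x ∧ Q x ⟧) * length (elements EB)
      ≡⟨ sym (∑-const (elements EB) _) ⟩
    ∑B (λ b → ∑X (λ x → ⟦ g x ∧ Q x ⟧))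
      ≡⟨ ∑-cong (elements EB) (λ b → sym (∑-involution EX (φ b) (φ-invol b) (λ x → ⟦ g x ∧ Q x ⟧))) ⟩
    ∑B (λ b → ∑X (λ x → ⟦ g (φ b x) ∧ Q (φ b x) ⟧))
      ≡⟨ ∑-cong (elements EB) (λ b → ∑-cong (elements EX) (λ x → cong (λ c → ⟦ c ∧ Q (φ b x) ⟧) (g-inv b x))) ⟩
    ∑B (λ b → ∑X (λ x → ⟦ g x ∧ Q (φ b x) ⟧))
      ≡⟨ ∑-comm (elements EB) (elements EX) _ ⟩
    ∑X (λ x → ∑B (λ b → ⟦ g x ∧ Q (φ b x) ⟧))
      ≡⟨ ∑-cong (elements EX) (λ x → trans (∑-cong (elements EB) (λ b → ⟦∧⟧ (g x) _)) (∑-*ˡ (elements EB) ⟦ g x ⟧ _)) ⟩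
    ∑X (λ x → ⟦ g x ⟧ * ∑B (λ b → ⟦ Q (φ b x) ⟧))
      ≤⟨ ∑-mono (elements EX) bounded ⟩
    ∑X (λ x → K * ⟦ g x ⟧)
      ≡⟨ ∑-*ˡ (elements EX) K _ ⟩
    K * ∑X (λ x → ⟦ g x ⟧) ∎
    where
    open ≤-Reasoning
    bounded : ∀ x → ⟦ g x ⟧ * ∑B (λ b → ⟦ Q (φ b x) ⟧) ≤ K * ⟦ g x ⟧
    bounded x with g x in gx
    ... | true  = ≤-trans (≤-reflexive (+-identityʳ _)) (≤-trans (few x gx) (≤-reflexive (sym (*-identityʳ K))))
    ... | false = z≤n

  iterated-switching-bound :
    ∀ {J : Set} (φ : J → B → X → X) (Q : J → X → Bool) (g : X → Bool) (L : List J) → Unique L →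
    (∀ {j} → j ∈ L → ∀ b x → φ j b (φ j b x) ≡ x) →
    (∀ {j} → j ∈ L → ∀ b x → g (φ j b x) ≡ g x) →
    (∀ {j j′} → j ∈ L → j′ ∈ L → j ≢ j′ → ∀ b x → Q j′ (φ j b x) ≡ Q j′ x) →
    (∀ {j} → j ∈ L → ∀ x → g x ≡ true → ∑B (λ b → ⟦ Q j (φ j b x) ⟧) ≤ K) →
    RatioBound (∑X (λ x → ⟦ g x ∧ allᵇ (λ j → Q j x) L ⟧)) (∑X (λ x → ⟦ g x ⟧)) K (length L)
  iterated-switching-bound φ Q g [] _ _ _ _ _ = ratioBound
    (≤-reflexive (trans (*-identityʳ _) (trans (∑-cong (elements EX) (λ x → cong ⟦_⟧ (∧-identityʳ (g x))))
                                                (sym (+-identityʳ _)))))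
  iterated-switching-bound φ Q g (j ∷ L) (j∉L ∷ unique) invol g-inv indep few = ratioBound (begin
    ∑X (λ x → ⟦ g x ∧ (Q j x ∧ allQ x) ⟧) * (suc K * suc K ^ length L)
      ≡⟨ cong (_* (suc K * suc K ^ length L)) (∑-cong (elements EX) (λ x → cong ⟦_⟧ (reorder (g x) (Q j x) _))) ⟩
    ∑X (λ x → ⟦ g′ x ∧ Q j x ⟧) * (suc K * suc K ^ length L)
      ≡⟨ sym (*-assoc (∑X (λ x → ⟦ g′ x ∧ Q j x ⟧)) (suc K) (suc K ^ length L)) ⟩
    ∑X (λ x → ⟦ g′ x ∧ Q j x ⟧) * suc K * suc K ^ length L
      ≤⟨ *-monoˡ-≤ (suc K ^ length L) (switching-bound (φ j) (invol (here refl)) g′ (Q j) g′-inv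
                                          (λ x g′x → few (here refl) x (proj₁ (∧-true g′x)))) ⟩
    K * ∑X (λ x → ⟦ g′ x ⟧) * suc K ^ length L
      ≡⟨ *-assoc K _ (suc K ^ length L) ⟩
    K * (∑X (λ x → ⟦ g′ x ⟧) * suc K ^ length L)
      ≤⟨ *-monoʳ-≤ K (RatioBound.cleared (iterated-switching-bound φ Q g L unique (λ m → invol (there m))
                        (λ m → g-inv (there m)) (λ m m′ → indep (there m) (there m′)) (λ m → few (there m)))) ⟩
    K * (K ^ length L * ∑X (λ x → ⟦ g x ⟧))
      ≡⟨ sym (*-assoc K (K ^ length L) _) ⟩
    K * K ^ length L * ∑X (λ x → ⟦ g x ⟧) ∎)
    where
    open ≤-Reasoning
    allQ g′ : X → Bool
    allQ x = allᵇ (λ j′ → Q j′ x) L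
    g′ x = g x ∧ allQ x
    reorder : ∀ a b c → a ∧ (b ∧ c) ≡ (a ∧ c) ∧ b
    reorder a b c = trans (cong (a ∧_) (∧-comm b c)) (sym (∧-assoc a c b))
    g′-inv : ∀ b x → g′ (φ j b x) ≡ g′ x
    g′-inv b x = cong₂ _∧_ (g-inv (here refl) b x)
      (allᵇ-cong L (λ m → indep (here refl) (there m) (All.lookup j∉L m) b x))

-- Graphs

adj-irrefl : ∀ {n} (G : Graph n) i → adj G i i ≡ false
adj-irrefl {suc n} (G , r) zero    = refl
adj-irrefl {suc n} (G , r) (suc i) = adj-irrefl G i

adj-sym : ∀ {n} (G : Graph n) i j → adj G i j ≡ adj G j i
adj-sym {suc n} (G , r) zero    zero    = refl
adj-sym {suc n} (G , r) zero    (suc j) = refl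
adj-sym {suc n} (G , r) (suc i) zero    = refl
adj-sym {suc n} (G , r) (suc i) (suc j) = adj-sym G i j

lookup-ext : ∀ {A : Set} {m} (v w : Vec A m) → (∀ i → lookup v i ≡ lookup w i) → v ≡ w
lookup-ext v w v≗w = trans (sym (tabulate∘lookup v)) (trans (tabulate-cong v≗w) (tabulate∘lookup w))

adj-ext : ∀ {n} (G H : Graph n) → (∀ i j → adj G i j ≡ adj H i j) → G ≡ H
adj-ext {zero}  tt      tt      _   = refl
adj-ext {suc n} (G , r) (H , s) G≗H =
  cong₂ _,_ (adj-ext G H (λ i j → G≗H (suc i) (suc j))) (lookup-ext r s (λ j → G≗H zero (suc j)))

fromAdj : ∀ {n} → (Fin n → Fin n → Bool) → Graph n
fromAdj {zero}  f = tt
fromAdj {suc n} f = fromAdj (λ i j → f (suc i) (suc j)) , tabulate (λ j → f zero (suc j))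

adj-fromAdj : ∀ {n} (f : Fin n → Fin n → Bool) → (∀ i j → f i j ≡ f j i) → (∀ i → f i i ≡ false) →
              ∀ i j → adj (fromAdj f) i j ≡ f i j
adj-fromAdj {suc n} f sym-f irrefl-f zero    zero    = sym (irrefl-f zero)
adj-fromAdj {suc n} f sym-f irrefl-f zero    (suc j) = lookup∘tabulate _ j
adj-fromAdj {suc n} f sym-f irrefl-f (suc i) zero    = trans (lookup∘tabulate _ i) (sym-f zero (suc i))
adj-fromAdj {suc n} f sym-f irrefl-f (suc i) (suc j) =
  adj-fromAdj (λ i j → f (suc i) (suc j)) (λ i j → sym-f (suc i) (suc j)) (λ i → irrefl-f (suc i)) i j

star : ∀ {n} → Fin n → (Fin n → Bool) → Fin n → Fin n → Bool
star v h a c = (a ==ᶠ v ∧ h c) xor (c ==ᶠ v ∧ h a)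

toggleStar : ∀ {n} → Graph n → Fin n → (Fin n → Bool) → Graph n
toggleStar G v h = fromAdj (λ a c → adj G a c xor star v h a c)

adj-toggleStar : ∀ {n} (G : Graph n) v h a c → adj (toggleStar G v h) a c ≡ adj G a c xor star v h a c
adj-toggleStar G v h = adj-fromAdj _
  (λ a c → cong₂ _xor_ (adj-sym G a c) (xor-comm (a ==ᶠ v ∧ h c) _))
  (λ a → cong₂ _xor_ (adj-irrefl G a) (xor-same (a ==ᶠ v ∧ h a)))

toggleStar-involutive : ∀ {n} (G : Graph n) v h h′ → (∀ x → h′ x ≡ h x) →
                        toggleStar (toggleStar G v h) v h′ ≡ G
toggleStar-involutive G v h h′ h′≗h = adj-ext _ G λ a c → begin
  adj (toggleStar (toggleStar G v h) v h′) a c      ≡⟨ adj-toggleStar (toggleStar G v h) v h′ a c ⟩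
  adj (toggleStar G v h) a c xor star v h′ a c      ≡⟨ cong₂ _xor_ (adj-toggleStar G v h a c) (star≡ a c) ⟩
  (adj G a c xor star v h a c) xor star v h a c     ≡⟨ xor-assoc (adj G a c) _ _ ⟩
  adj G a c xor (star v h a c xor star v h a c)     ≡⟨ cong (adj G a c xor_) (xor-same (star v h a c)) ⟩
  adj G a c xor false                               ≡⟨ xor-identityʳ (adj G a c) ⟩
  adj G a c                                         ∎
  where
  open ≡-Reasoning
  star≡ : ∀ a c → star v h′ a c ≡ star v h a c
  star≡ a c = cong₂ _xor_ (cong (a ==ᶠ v ∧_) (h′≗h c)) (cong (c ==ᶠ v ∧_) (h′≗h a))

commonNbrs≡∑ : ∀ {n} (G : Graph n) xs → commonNbrs G xs ≡ ∑ (allFin n) (λ y → ⟦ allᵇ (adj G y) xs ⟧)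
commonNbrs≡∑ {n} G xs = length-filterᵇ (λ y → allᵇ (adj G y) xs) (allFin n)

Untouched : ∀ {n} → Fin n → (Fin n → Bool) → Fin n → Set
Untouched v h x = x ==ᶠ v ≡ false × h x ≡ false

adj-toggleStar-untouched : ∀ {n} (G : Graph n) v h y x → Untouched v h x →
                           adj (toggleStar G v h) y x ≡ adj G y x
adj-toggleStar-untouched G v h y x (x≢v , hx≡false) = begin
  adj (toggleStar G v h) y x                               ≡⟨ adj-toggleStar G v h y x ⟩
  adj G y x xor ((y ==ᶠ v ∧ h x) xor (x ==ᶠ v ∧ h y))      ≡⟨ cong (λ b → adj G y x xor ((y ==ᶠ v ∧ b) xor (x ==ᶠ v ∧ h y))) hx≡false ⟩
  adj G y x xor ((y ==ᶠ v ∧ false) xor (x ==ᶠ v ∧ h y))    ≡⟨ cong₂ (λ b c → adj G y x xor (b xor (c ∧ h y))) (∧-zeroʳ (y ==ᶠ v)) x≢v ⟩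
  adj G y x xor false                                      ≡⟨ xor-identityʳ _ ⟩
  adj G y x                                                ∎
  where open ≡-Reasoning

commonNbrs-toggleStar : ∀ {n} (G : Graph n) v h xs → All (Untouched v h) xs →
                        commonNbrs (toggleStar G v h) xs ≡ commonNbrs G xs
commonNbrs-toggleStar {n} G v h xs untouched = begin
  commonNbrs (toggleStar G v h) xs                        ≡⟨ commonNbrs≡∑ (toggleStar G v h) xs ⟩
  ∑ (allFin n) (λ y → ⟦ allᵇ (adj (toggleStar G v h) y) xs ⟧) ≡⟨ ∑-cong (allFin n) (λ y → cong ⟦_⟧ (allᵇ-untouched y)) ⟩
  ∑ (allFin n) (λ y → ⟦ allᵇ (adj G y) xs ⟧)              ≡⟨ sym (commonNbrs≡∑ G xs) ⟩
  commonNbrs G xs                                         ∎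
  where
  open ≡-Reasoning
  allᵇ-untouched : ∀ y → allᵇ (adj (toggleStar G v h) y) xs ≡ allᵇ (adj G y) xs
  allᵇ-untouched y = allᵇ-cong xs (λ x∈xs → adj-toggleStar-untouched G v h y _ (All.lookup untouched x∈xs))

isOdd-commonNbrs-toggleStar :
  ∀ {n} (G : Graph n) v h xs → h v ≡ false → All (Untouched v h) xs →
  isOdd (commonNbrs (toggleStar G v h) (v ∷ xs)) ≡
  isOdd (commonNbrs G (v ∷ xs)) xor isOdd (∑ (allFin n) (λ y → ⟦ h y ∧ allᵇ (adj G y) xs ⟧))
isOdd-commonNbrs-toggleStar {n} G v h xs hv≡false untouched = begin
  isOdd (commonNbrs G′ (v ∷ xs))
    ≡⟨ cong isOdd (trans (commonNbrs≡∑ G′ (v ∷ xs)) (∑-cong (allFin n) (λ y → cong ⟦_⟧ (cong₂ _∧_ (adj-at-v y) (allᵇ-xs y))))) ⟩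
  isOdd (∑ (allFin n) (λ y → ⟦ (adj G y v xor h y) ∧ allᵇ (adj G y) xs ⟧))
    ≡⟨ cong isOdd (∑-cong (allFin n) (λ y → cong ⟦_⟧ (∧-distribʳ-xor (allᵇ (adj G y) xs) (adj G y v) (h y)))) ⟩
  isOdd (∑ (allFin n) (λ y → ⟦ (adj G y v ∧ allᵇ (adj G y) xs) xor (h y ∧ allᵇ (adj G y) xs) ⟧))
    ≡⟨ isOdd-∑-xor (allFin n) _ _ ⟩
  isOdd (∑ (allFin n) (λ y → ⟦ allᵇ (adj G y) (v ∷ xs) ⟧)) xor isOdd (∑ (allFin n) (λ y → ⟦ h y ∧ allᵇ (adj G y) xs ⟧))
    ≡⟨ cong (_xor _) (cong isOdd (sym (commonNbrs≡∑ G (v ∷ xs)))) ⟩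
  isOdd (commonNbrs G (v ∷ xs)) xor isOdd (∑ (allFin n) (λ y → ⟦ h y ∧ allᵇ (adj G y) xs ⟧)) ∎
  where
  open ≡-Reasoning
  G′ = toggleStar G v h
  adj-at-v : ∀ y → adj G′ y v ≡ adj G y v xor h y
  adj-at-v y = begin
    adj G′ y v
      ≡⟨ adj-toggleStar G v h y v ⟩
    adj G y v xor ((y ==ᶠ v ∧ h v) xor (v ==ᶠ v ∧ h y))
      ≡⟨ cong₂ (λ b c → adj G y v xor ((y ==ᶠ v ∧ b) xor (c ∧ h y))) hv≡false (==ᶠ-refl v) ⟩
    adj G y v xor ((y ==ᶠ v ∧ false) xor h y)
      ≡⟨ cong (λ b → adj G y v xor (b xor h y)) (∧-zeroʳ (y ==ᶠ v)) ⟩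
    adj G y v xor h y ∎
  allᵇ-xs : ∀ y → allᵇ (adj G′ y) xs ≡ allᵇ (adj G y) xs
  allᵇ-xs y = allᵇ-cong xs (λ x∈xs → adj-toggleStar-untouched G v h y _ (All.lookup untouched x∈xs))

-- Lists, bit vectors and subsets

≢⇒==ᶠ-false : ∀ {n} (i j : Fin n) → i ≢ j → i ==ᶠ j ≡ false
≢⇒==ᶠ-false i j = ==-false (enumFin _)

==ᶠ-false⇒≢ : ∀ {n} {i j : Fin n} → i ==ᶠ j ≡ false → i ≢ j
==ᶠ-false⇒≢ {i = i} eq refl with trans (sym eq) (==ᶠ-refl i)
... | ()

lookup-injective : ∀ {A : Set} {xs : List A} → Unique xs → ∀ i j → List.lookup xs i ≡ List.lookup xs j → i ≡ j
lookup-injective {xs = x ∷ xs} (x∉xs ∷ _)      zero    zero    _  = refl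
lookup-injective {xs = x ∷ xs} (x∉xs ∷ _)      zero    (suc j) eq = ⊥-elim (All.lookup x∉xs (∈-lookup j) eq)
lookup-injective {xs = x ∷ xs} (x∉xs ∷ _)      (suc i) zero    eq = ⊥-elim (All.lookup x∉xs (∈-lookup i) (sym eq))
lookup-injective {xs = x ∷ xs} (_    ∷ unique) (suc i) (suc j) eq = cong suc (lookup-injective unique i j eq)

findᵇ-just : ∀ {A : Set} (p : A → Bool) xs {y} → findᵇ p xs ≡ just y → p y ≡ true × y ∈ xs
findᵇ-just p (x ∷ xs) eq with p x in px
findᵇ-just p (x ∷ xs) refl | true  = px , here refl
...                         | false = let (py , y∈xs) = findᵇ-just p xs eq in py , there y∈xs

findᵇ-nothing : ∀ {A : Set} (p : A → Bool) xs → findᵇ p xs ≡ nothing → allᵇ (λ x → not (p x)) xs ≡ true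
findᵇ-nothing p []       _  = refl
findᵇ-nothing p (x ∷ xs) eq with p x
... | false = findᵇ-nothing p xs eq

findᵇ-cong : ∀ {A : Set} {p q : A → Bool} xs → (∀ {x} → x ∈ xs → p x ≡ q x) → findᵇ p xs ≡ findᵇ q xs
findᵇ-cong []       p≗q = refl
findᵇ-cong (x ∷ xs) p≗q rewrite p≗q (here refl) =
  cong (if _ then just x else_) (findᵇ-cong xs (λ x∈xs → p≗q (there x∈xs)))

allᵇ⇒ : ∀ {A : Set} (p : A → Bool) {xs x} → allᵇ p xs ≡ true → x ∈ xs → p x ≡ true
allᵇ⇒ p {x ∷ xs} eq (here refl)  = proj₁ (∧-true eq)
allᵇ⇒ p {x ∷ xs} eq (there x∈xs) = allᵇ⇒ p (proj₂ (∧-true {p x} eq)) x∈xs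

⇒allᵇ : ∀ {A : Set} (p : A → Bool) xs → (∀ x → p x ≡ true) → allᵇ p xs ≡ true
⇒allᵇ p []       _  = refl
⇒allᵇ p (x ∷ xs) px = cong₂ _∧_ (px x) (⇒allᵇ p xs px)

allᵇ-false : ∀ {A : Set} (p : A → Bool) xs → allᵇ p xs ≡ false → ∃[ x ] (x ∈ xs × p x ≡ false)
allᵇ-false p (x ∷ xs) eq with p x in px
... | false = x , here refl , px
... | true  = let (y , y∈xs , py) = allᵇ-false p xs eq in y , there y∈xs , py

⟦not-allᵇ⟧≤ : ∀ {A : Set} (p : A → Bool) xs → ⟦ not (allᵇ p xs) ⟧ ≤ ∑ xs (λ x → ⟦ not (p x) ⟧)
⟦not-allᵇ⟧≤ p []       = z≤n
⟦not-allᵇ⟧≤ p (x ∷ xs) with p x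
... | true  = ⟦not-allᵇ⟧≤ p xs
... | false = s≤s z≤n

bitVectors : ∀ m → List (Vec Bool m)
bitVectors m = elements (enumVec enumBool m)

_==ᵛ_ : ∀ {m} → Vec Bool m → Vec Bool m → Bool
_==ᵛ_ {m} = _==_ (enumVec enumBool m)

_xorᵛ_ : ∀ {m} → Vec Bool m → Vec Bool m → Vec Bool m
_xorᵛ_ = zipWith _xor_

xorᵛ-cancelˡ : ∀ {m} (c b : Vec Bool m) → c xorᵛ (c xorᵛ b) ≡ b
xorᵛ-cancelˡ c b = lookup-ext _ _ λ i → begin
  lookup (c xorᵛ (c xorᵛ b)) i                 ≡⟨ lookup-zipWith _xor_ i c _ ⟩
  lookup c i xor lookup (c xorᵛ b) i           ≡⟨ cong (lookup c i xor_) (lookup-zipWith _xor_ i c b) ⟩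
  lookup c i xor (lookup c i xor lookup b i)   ≡⟨ sym (xor-assoc (lookup c i) _ _) ⟩
  (lookup c i xor lookup c i) xor lookup b i   ≡⟨ cong (_xor lookup b i) (xor-same (lookup c i)) ⟩
  lookup b i                                   ∎
  where open ≡-Reasoning

-- Exactly one b has c xorᵛ b = τ.
∑-xorᵛ-≢ : ∀ {m} (c τ : Vec Bool m) → ∑ (bitVectors m) (λ b → ⟦ not ((c xorᵛ b) ==ᵛ τ) ⟧) ≡ 2 ^ m ∸ 1
∑-xorᵛ-≢ {m} c τ = begin
  ∑ Bs (λ b → ⟦ not (hit b) ⟧)                              ≡⟨ sym (m+n∸n≡m _ 1) ⟩
  ∑ Bs (λ b → ⟦ not (hit b) ⟧) + 1 ∸ 1                      ≡⟨ cong (λ z → ∑ Bs (λ b → ⟦ not (hit b) ⟧) + z ∸ 1) (sym one) ⟩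
  ∑ Bs (λ b → ⟦ not (hit b) ⟧) + ∑ Bs (λ b → ⟦ hit b ⟧) ∸ 1 ≡⟨ cong (_∸ 1) (sym (∑-+ Bs _ _)) ⟩
  ∑ Bs (λ b → ⟦ not (hit b) ⟧ + ⟦ hit b ⟧) ∸ 1              ≡⟨ cong (_∸ 1) (∑-cong Bs (λ b → trans (+-comm ⟦ not (hit b) ⟧ _) (⟦⟧+⟦not⟧ (hit b)))) ⟩
  ∑ Bs (λ _ → 1) ∸ 1                                        ≡⟨ cong (_∸ 1) (trans (sym (length≡∑1 Bs)) (length-enumVec enumBool m)) ⟩
  2 ^ m ∸ 1                                                 ∎
  where
  open ≡-Reasoning
  Bs = bitVectors m
  hit : Vec Bool m → Bool
  hit b = (c xorᵛ b) ==ᵛ τ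
  one : ∑ Bs (λ b → ⟦ hit b ⟧) ≡ 1
  one = trans (∑-involution (enumVec enumBool m) (c xorᵛ_) (xorᵛ-cancelˡ c) (λ b → ⟦ b ==ᵛ τ ⟧))
              (∑-== (enumVec enumBool m) τ)

_⊆ᵇ_ : ∀ {k} → Subset k → Subset k → Bool
[]          ⊆ᵇ []      = true
(true  ∷ σ) ⊆ᵇ (c ∷ τ) = c ∧ σ ⊆ᵇ τ
(false ∷ σ) ⊆ᵇ (c ∷ τ) = σ ⊆ᵇ τ

⊆ᵇ-refl : ∀ {k} (σ : Subset k) → σ ⊆ᵇ σ ≡ true
⊆ᵇ-refl []          = refl
⊆ᵇ-refl (true  ∷ σ) = ⊆ᵇ-refl σ
⊆ᵇ-refl (false ∷ σ) = ⊆ᵇ-refl σ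

⊆ᵇ⇒∣∣≤ : ∀ {k} (σ τ : Subset k) → σ ⊆ᵇ τ ≡ true → ∣ σ ∣ ≤ ∣ τ ∣
⊆ᵇ⇒∣∣≤ []          []          _   = z≤n
⊆ᵇ⇒∣∣≤ (true  ∷ σ) (true  ∷ τ) σ⊆τ = s≤s (⊆ᵇ⇒∣∣≤ σ τ σ⊆τ)
⊆ᵇ⇒∣∣≤ (false ∷ σ) (true  ∷ τ) σ⊆τ = m≤n⇒m≤1+n (⊆ᵇ⇒∣∣≤ σ τ σ⊆τ)
⊆ᵇ⇒∣∣≤ (false ∷ σ) (false ∷ τ) σ⊆τ = ⊆ᵇ⇒∣∣≤ σ τ σ⊆τ

⊆ᵇ-∣∣≡⇒≡ : ∀ {k} (σ τ : Subset k) → σ ⊆ᵇ τ ≡ true → ∣ σ ∣ ≡ ∣ τ ∣ → σ ≡ τ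
⊆ᵇ-∣∣≡⇒≡ []          []          _   _  = refl
⊆ᵇ-∣∣≡⇒≡ (true  ∷ σ) (true  ∷ τ) σ⊆τ eq = cong (true ∷_) (⊆ᵇ-∣∣≡⇒≡ σ τ σ⊆τ (suc-injective eq))
⊆ᵇ-∣∣≡⇒≡ (false ∷ σ) (true  ∷ τ) σ⊆τ eq = ⊥-elim (<⇒≱ (s≤s (⊆ᵇ⇒∣∣≤ σ τ σ⊆τ)) (≤-reflexive (sym eq)))
⊆ᵇ-∣∣≡⇒≡ (false ∷ σ) (false ∷ τ) σ⊆τ eq = cong (false ∷_) (⊆ᵇ-∣∣≡⇒≡ σ τ σ⊆τ eq)

allᵇ-pick : ∀ {n k} (f : Fin n → Bool) (S : Vec (Fin n) k) σ → allᵇ f (pick S σ) ≡ σ ⊆ᵇ Vec.map f S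
allᵇ-pick f []      []          = refl
allᵇ-pick f (s ∷ S) (true  ∷ σ) = cong (f s ∧_) (allᵇ-pick f S σ)
allᵇ-pick f (s ∷ S) (false ∷ σ) = allᵇ-pick f S σ

length-pick : ∀ {n k} (S : Vec (Fin n) k) σ → length (pick S σ) ≡ ∣ σ ∣
length-pick []      []          = refl
length-pick (s ∷ S) (true  ∷ σ) = cong suc (length-pick S σ)
length-pick (s ∷ S) (false ∷ σ) = length-pick S σ

All-pick : ∀ {n k} {P : Fin n → Set} (S : Vec (Fin n) k) σ → (∀ i → P (lookup S i)) → All P (pick S σ)
All-pick []      []          _  = []
All-pick (s ∷ S) (true  ∷ σ) PS = PS zero ∷ All-pick S σ (λ i → PS (suc i))
All-pick (s ∷ S) (false ∷ σ) PS = All-pick S σ (λ i → PS (suc i))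

pick-unique : ∀ {n k} (S : Vec (Fin n) k) σ → (∀ i j → lookup S i ≡ lookup S j → i ≡ j) → Unique (pick S σ)
pick-unique []      []          _   = []
pick-unique (s ∷ S) (true  ∷ σ) inj =
  All-pick S σ (λ i s≡Si → 0≢suc (inj zero (suc i) s≡Si)) ∷ pick-unique S σ (λ i j eq → suc-inj (inj (suc i) (suc j) eq))
  where
  0≢suc : ∀ {m} {i : Fin m} → Fin.zero {m} ≢ suc i
  0≢suc ()
  suc-inj : ∀ {m} {i j : Fin m} → Fin.suc i ≡ suc j → i ≡ j
  suc-inj refl = refl
pick-unique (s ∷ S) (false ∷ σ) inj = pick-unique S σ (λ i j eq → suc-inj (inj (suc i) (suc j) eq))
  where
  suc-inj : ∀ {m} {i j : Fin m} → Fin.suc i ≡ suc j → i ≡ j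
  suc-inj refl = refl

module SizedSubsets (k s : ℕ) where

  subsets : List (Subset k)
  subsets = filterᵇ (λ σ → ∣ σ ∣ ≡ᵇ s) (bitVectors k)

  #subsets : ℕ
  #subsets = length subsets

  subset : Fin #subsets → Subset k
  subset = List.lookup subsets

  ∣subset∣ : ∀ j → ∣ subset j ∣ ≡ s
  ∣subset∣ j = ≡ᵇ⇒≡ _ s (proj₂ (∈-filter⁻ (λ σ → T? (∣ σ ∣ ≡ᵇ s)) {xs = bitVectors k} (∈-lookup j)))

  subset-injective : ∀ i j → subset i ≡ subset j → i ≡ j
  subset-injective = lookup-injective (Unique.filter⁺ _ (elements-unique (enumVec enumBool k)))

  subset-⊆ᵇ : ∀ i j → subset i ⊆ᵇ subset j ≡ j ==ᶠ i
  subset-⊆ᵇ i j with j ==ᶠ i in eq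
  ... | true  = subst (λ x → subset i ⊆ᵇ subset x ≡ true) (sym (==ᶠ⇒≡ eq)) (⊆ᵇ-refl (subset i))
  ... | false with subset i ⊆ᵇ subset j in i⊆j
  ...   | false = refl
  ...   | true  = ⊥-elim (==ᶠ-false⇒≢ eq (sym (subset-injective i j
                    (⊆ᵇ-∣∣≡⇒≡ _ _ i⊆j (trans (∣subset∣ i) (sym (∣subset∣ j)))))))

  subset-surjective : ∀ σ → ∣ σ ∣ ≡ s → ∃[ j ] subset j ≡ σ
  subset-surjective σ ∣σ∣≡s = index σ∈subsets , sym (lookup-index σ∈subsets)
    where
    σ∈subsets : σ ∈ subsets
    σ∈subsets = ∈-filter⁺ (λ σ → T? (∣ σ ∣ ≡ᵇ s)) (∈-elements (enumVec enumBool k) σ) (≡⇒≡ᵇ _ s ∣σ∣≡s)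

_∈ᵇ_ : ∀ {n m} → Fin n → Vec (Fin n) m → Bool
y ∈ᵇ []      = false
y ∈ᵇ (s ∷ S) = y ==ᶠ s ∨ y ∈ᵇ S

∉ᵇ⇒==ᶠ-false : ∀ {n m} {y : Fin n} (S : Vec (Fin n) m) → y ∈ᵇ S ≡ false → ∀ i → y ==ᶠ lookup S i ≡ false
∉ᵇ⇒==ᶠ-false (s ∷ S) y∉S zero    = proj₁ (∨-false y∉S)
∉ᵇ⇒==ᶠ-false {y = y} (s ∷ S) y∉S (suc i) = ∉ᵇ⇒==ᶠ-false S (proj₂ (∨-false {y ==ᶠ s} y∉S)) i

lookup-∈ᵇ : ∀ {n m} (S : Vec (Fin n) m) i → lookup S i ∈ᵇ S ≡ true
lookup-∈ᵇ (s ∷ S) zero    = cong (_∨ s ∈ᵇ S) (==ᶠ-refl s)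
lookup-∈ᵇ (s ∷ S) (suc i) = trans (cong (lookup S i ==ᶠ s ∨_) (lookup-∈ᵇ S i)) (∨-zeroʳ _)

∑-∈ᵇ≤ : ∀ {n m} (S : Vec (Fin n) m) → ∑ (allFin n) (λ y → ⟦ y ∈ᵇ S ⟧) ≤ m
∑-∈ᵇ≤ {n} []      = ≤-reflexive (∑-const (allFin n) 0)
∑-∈ᵇ≤ {n} (s ∷ S) = begin
  ∑ (allFin n) (λ y → ⟦ y ==ᶠ s ∨ y ∈ᵇ S ⟧)                            ≤⟨ ∑-mono (allFin n) (λ y → ⟦∨⟧≤ (y ==ᶠ s) (y ∈ᵇ S)) ⟩
  ∑ (allFin n) (λ y → ⟦ y ==ᶠ s ⟧ + ⟦ y ∈ᵇ S ⟧)                        ≡⟨ ∑-+ (allFin n) _ _ ⟩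
  ∑ (allFin n) (λ y → ⟦ y ==ᶠ s ⟧) + ∑ (allFin n) (λ y → ⟦ y ∈ᵇ S ⟧)  ≤⟨ +-mono-≤ (≤-reflexive (∑-== (enumFin n) s)) (∑-∈ᵇ≤ S) ⟩
  suc _                                                              ∎
  where open ≤-Reasoning

any-false : ∀ {A : Set} (p : A → Bool) {xs x} → any p xs ≡ false → x ∈ xs → p x ≡ false
any-false p {x ∷ xs} eq (here refl)  = proj₁ (∨-false eq)
any-false p {x ∷ xs} eq (there x∈xs) = any-false p (proj₂ (∨-false {p x} eq)) x∈xs

⟦any⟧≤ : ∀ {A : Set} (p : A → Bool) xs → ⟦ any p xs ⟧ ≤ ∑ xs (λ x → ⟦ p x ⟧)
⟦any⟧≤ p []       = z≤n
⟦any⟧≤ p (x ∷ xs) = ≤-trans (⟦∨⟧≤ (p x) _) (+-monoʳ-≤ ⟦ p x ⟧ (⟦any⟧≤ p xs))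

-- Candidates and witnesses

module Extension {n k : ℕ} (S : Vec (Fin n) k) (s : ℕ) (U W : List (Fin n))
                 (U-unique : Unique U) (W-unique : Unique W)
                 (U∉S : ∀ {u} → u ∈ U → u ∈ᵇ S ≡ false) (W∉S : ∀ {w} → w ∈ W → w ∈ᵇ S ≡ false)
                 (U∉W : ∀ {u} → u ∈ U → u ∉ W) where

  open SizedSubsets k s

  nbrIn : Graph n → Fin n → Vec Bool k
  nbrIn G y = Vec.map (adj G y) S

  witness : Graph n → Fin #subsets → Maybe (Fin n)
  witness G j = findᵇ (λ y → nbrIn G y ==ᵛ subset j) W

  hasWitnesses : Graph n → Bool
  hasWitnesses G = allᵇ (λ j → is-just (witness G j)) (allFin #subsets)

  isWitness : Graph n → Fin #subsets → Fin n → Bool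
  isWitness G j y = maybe (_==ᶠ y) false (witness G j)

  -- Distinct l have distinct witnesses, so this parity is the disjunction over l of (b l ∧ y is the witness of l).
  selected : Graph n → Vec Bool #subsets → Fin n → Bool
  selected G b y = isOdd (∑ (allFin #subsets) (λ l → ⟦ lookup b l ∧ isWitness G l y ⟧))

  switchCandidate : Fin n → Vec Bool #subsets → Graph n → Graph n
  switchCandidate v b G = toggleStar G v (selected G b)

  profile : Graph n → Fin n → Vec Bool #subsets
  profile G v = tabulate (λ j → isOdd (commonNbrs G (v ∷ pick S (subset j))))

  lacksWitness : Fin #subsets → Graph n → Bool
  lacksWitness j G = allᵇ (λ y → not (nbrIn G y ==ᵛ subset j)) W

  nbrIn-toggleStar : ∀ G v h y → y ==ᶠ v ≡ false → v ∈ᵇ S ≡ false → nbrIn (toggleStar G v h) y ≡ nbrIn G y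
  nbrIn-toggleStar G v h y y≢v v∉S = lookup-ext _ _ λ i → begin
    lookup (nbrIn (toggleStar G v h) y) i
      ≡⟨ lookup-map i _ S ⟩
    adj (toggleStar G v h) y (lookup S i)
      ≡⟨ adj-toggleStar G v h y (lookup S i) ⟩
    adj G y (lookup S i) xor ((y ==ᶠ v ∧ h _) xor (lookup S i ==ᶠ v ∧ h y))
      ≡⟨ cong₂ (λ a b → adj G y (lookup S i) xor ((a ∧ h _) xor (b ∧ h y))) y≢v (Si≢v i) ⟩
    adj G y (lookup S i) xor false
      ≡⟨ xor-identityʳ _ ⟩
    adj G y (lookup S i)
      ≡⟨ lookup-map i _ S ⟨
    lookup (nbrIn G y) i ∎
    where
    open ≡-Reasoning
    Si≢v : ∀ i → lookup S i ==ᶠ v ≡ false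
    Si≢v i = trans (==ᶠ-sym (lookup S i) v) (∉ᵇ⇒==ᶠ-false S v∉S i)

  witness-just : ∀ G j {w} → witness G j ≡ just w → w ∈ W × nbrIn G w ≡ subset j
  witness-just G j eq =
    let (match , w∈W) = findᵇ-just (λ y → nbrIn G y ==ᵛ subset j) W eq in w∈W , ==⇒≡ (enumVec enumBool k) match

  isWitness-∉W : ∀ G l {x} → x ∉ W → isWitness G l x ≡ false
  isWitness-∉W G l {x} x∉W with witness G l in eq
  ... | nothing = refl
  ... | just w  = ≢⇒==ᶠ-false w x (λ { refl → x∉W (proj₁ (witness-just G l eq)) })

  selected-∉W : ∀ G b {x} → x ∉ W → selected G b x ≡ false
  selected-∉W G b x∉W = cong isOdd (trans (∑-cong (allFin #subsets) λ l →
      cong ⟦_⟧ (trans (cong (lookup b l ∧_) (isWitness-∉W G l x∉W)) (∧-zeroʳ (lookup b l))))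
    (∑-const (allFin #subsets) 0))

  lookup-S∉W : ∀ i → lookup S i ∉ W
  lookup-S∉W i Si∈W with trans (sym (lookup-∈ᵇ S i)) (W∉S Si∈W)
  ... | ()

  module _ {v : Fin n} (v∈U : v ∈ U) where

    witness-switchCandidate : ∀ b G j → witness (switchCandidate v b G) j ≡ witness G j
    witness-switchCandidate b G j = findᵇ-cong W λ {y} y∈W →
      cong (_==ᵛ subset j) (nbrIn-toggleStar G v (selected G b) y (≢⇒==ᶠ-false y v (λ { refl → U∉W v∈U y∈W })) (U∉S v∈U))

    hasWitnesses-switchCandidate : ∀ b G → hasWitnesses (switchCandidate v b G) ≡ hasWitnesses G
    hasWitnesses-switchCandidate b G =
      allᵇ-cong (allFin #subsets) (λ {j} _ → cong is-just (witness-switchCandidate b G j))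

    switchCandidate-involutive : ∀ b G → switchCandidate v b (switchCandidate v b G) ≡ G
    switchCandidate-involutive b G = toggleStar-involutive G v (selected G b) _ λ y →
      cong isOdd (∑-cong (allFin #subsets) (λ l →
        cong (λ w → ⟦ lookup b l ∧ maybe (_==ᶠ y) false w ⟧) (witness-switchCandidate b G l)))

    untouched-pick : ∀ G b σ → All (Untouched v (selected G b)) (pick S σ)
    untouched-pick G b σ = All-pick S σ λ i →
      trans (==ᶠ-sym (lookup S i) v) (∉ᵇ⇒==ᶠ-false S (U∉S v∈U) i) , selected-∉W G b (lookup-S∉W i)

    profile-switchCandidate-other : ∀ b G {v′} → v′ ∈ U → v′ ==ᶠ v ≡ false →
                                    profile (switchCandidate v b G) v′ ≡ profile G v′
    profile-switchCandidate-other b G v′∈U v′≢v = tabulate-cong λ j →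
      cong isOdd (commonNbrs-toggleStar G v (selected G b) (_ ∷ pick S (subset j))
        ((v′≢v , selected-∉W G b (U∉W v′∈U)) ∷ untouched-pick G b (subset j)))

  hasWitnesses⇒witness : ∀ G → hasWitnesses G ≡ true → ∀ l → ∃[ w ] witness G l ≡ just w
  hasWitnesses⇒witness G has l with witness G l | allᵇ⇒ (λ j → is-just (witness G j)) has (∈-elements (enumFin _) l)
  ... | just w | _ = w , refl

  -- The witness of l is a common neighbour of subset j iff subset j ⊆ subset l, i.e. iff l = j.
  ∑-isWitness : ∀ G → hasWitnesses G ≡ true → ∀ (b : Vec Bool #subsets) j l →
                ∑ (allFin n) (λ y → ⟦ allᵇ (adj G y) (pick S (subset j)) ∧ (lookup b l ∧ isWitness G l y) ⟧)
                ≡ ⟦ l ==ᶠ j ⟧ * ⟦ lookup b l ⟧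
  ∑-isWitness G has b j l with hasWitnesses⇒witness G has l
  ... | w , eq rewrite eq = begin
    ∑ (allFin n) (λ y → ⟦ a y ∧ (lookup b l ∧ w ==ᶠ y) ⟧)     ≡⟨ ∑-cong (allFin n) (λ y → trans (cong ⟦_⟧ (reorder y)) (⟦∧⟧ (y ==ᶠ w) _)) ⟩
    ∑ (allFin n) (λ y → ⟦ y ==ᶠ w ⟧ * ⟦ a y ∧ lookup b l ⟧)    ≡⟨ ∑-Kronecker (enumFin n) w (λ y → ⟦ a y ∧ lookup b l ⟧) ⟩
    ⟦ a w ∧ lookup b l ⟧                                      ≡⟨ cong (λ c → ⟦ c ∧ lookup b l ⟧) a-w ⟩
    ⟦ l ==ᶠ j ∧ lookup b l ⟧                                  ≡⟨ ⟦∧⟧ (l ==ᶠ j) _ ⟩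
    ⟦ l ==ᶠ j ⟧ * ⟦ lookup b l ⟧                              ∎
    where
    open ≡-Reasoning
    a : Fin n → Bool
    a y = allᵇ (adj G y) (pick S (subset j))
    reorder : ∀ y → a y ∧ (lookup b l ∧ w ==ᶠ y) ≡ y ==ᶠ w ∧ (a y ∧ lookup b l)
    reorder y = trans (sym (∧-assoc (a y) _ _)) (trans (∧-comm _ (w ==ᶠ y)) (cong (_∧ _) (==ᶠ-sym w y)))
    a-w : a w ≡ l ==ᶠ j
    a-w = trans (allᵇ-pick (adj G w) S (subset j))
                (trans (cong (subset j ⊆ᵇ_) (proj₂ (witness-just G l eq))) (subset-⊆ᵇ j l))

  isOdd-∑-selected : ∀ G → hasWitnesses G ≡ true → ∀ (b : Vec Bool #subsets) j →
                     isOdd (∑ (allFin n) (λ y → ⟦ selected G b y ∧ allᵇ (adj G y) (pick S (subset j)) ⟧)) ≡ lookup b j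
  isOdd-∑-selected G has b j = begin
    isOdd (∑ (allFin n) (λ y → ⟦ selected G b y ∧ a y ⟧))
      ≡⟨ cong isOdd (∑-cong (allFin n) (λ y → cong ⟦_⟧ (trans (∧-comm (selected G b y) (a y))
                                                                (∧-isOdd-∑ (allFin #subsets) (a y) _)))) ⟩
    isOdd (∑ (allFin n) (λ y → ⟦ isOdd (∑ (allFin #subsets) (λ l → ⟦ a y ∧ (lookup b l ∧ isWitness G l y) ⟧)) ⟧))
      ≡⟨ isOdd-∑-isOdd (allFin n) _ ⟩
    isOdd (∑ (allFin n) (λ y → ∑ (allFin #subsets) (λ l → ⟦ a y ∧ (lookup b l ∧ isWitness G l y) ⟧)))
      ≡⟨ cong isOdd (∑-comm (allFin n) (allFin #subsets) _) ⟩
    isOdd (∑ (allFin #subsets) (λ l → ∑ (allFin n) (λ y → ⟦ a y ∧ (lookup b l ∧ isWitness G l y) ⟧)))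
      ≡⟨ cong isOdd (∑-cong (allFin #subsets) (∑-isWitness G has b j)) ⟩
    isOdd (∑ (allFin #subsets) (λ l → ⟦ l ==ᶠ j ⟧ * ⟦ lookup b l ⟧))
      ≡⟨ cong isOdd (∑-Kronecker (enumFin #subsets) j (λ l → ⟦ lookup b l ⟧)) ⟩
    isOdd ⟦ lookup b j ⟧
      ≡⟨ isOdd-⟦⟧ (lookup b j) ⟩
    lookup b j ∎
    where
    open ≡-Reasoning
    a : Fin n → Bool
    a y = allᵇ (adj G y) (pick S (subset j))

  profile-switchCandidate : ∀ {v} → v ∈ U → ∀ G → hasWitnesses G ≡ true → ∀ b →
                            profile (switchCandidate v b G) v ≡ profile G v xorᵛ b
  profile-switchCandidate {v} v∈U G has b = lookup-ext _ _ λ j → begin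
    lookup (profile (switchCandidate v b G) v) j
      ≡⟨ lookup∘tabulate _ j ⟩
    isOdd (commonNbrs (switchCandidate v b G) (v ∷ pick S (subset j)))
      ≡⟨ isOdd-commonNbrs-toggleStar G v (selected G b) _ (selected-∉W G b (U∉W v∈U)) (untouched-pick v∈U G b (subset j)) ⟩
    isOdd (commonNbrs G (v ∷ pick S (subset j))) xor isOdd (∑ (allFin n) (λ y → ⟦ selected G b y ∧ _ ⟧))
      ≡⟨ cong₂ _xor_ (sym (lookup∘tabulate _ j)) (isOdd-∑-selected G has b j) ⟩
    lookup (profile G v) j xor lookup b j
      ≡⟨ lookup-zipWith _xor_ j (profile G v) b ⟨
    lookup (profile G v xorᵛ b) j ∎
    where open ≡-Reasoning

  private
    allGraphs : List (Graph n)
    allGraphs = elements (enumGraph n)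

  candidates-bound : ∀ (τ : Vec Bool #subsets) →
    RatioBound (∑ allGraphs (λ G → ⟦ hasWitnesses G ∧ allᵇ (λ v → not (profile G v ==ᵛ τ)) U ⟧))
               (∑ allGraphs (λ G → ⟦ hasWitnesses G ⟧)) (2 ^ #subsets ∸ 1) (length U)
  candidates-bound τ =
    Switching.iterated-switching-bound (enumGraph n) (enumVec enumBool #subsets)
      (trans (length-enumVec enumBool #subsets) (sym (1+[2^m∸1]≡2^m #subsets)))
      (λ v b → switchCandidate v b) (λ v G → not (profile G v ==ᵛ τ)) hasWitnesses
      U U-unique
      (λ v∈U → switchCandidate-involutive v∈U)
      (λ v∈U → hasWitnesses-switchCandidate v∈U)
      (λ {v} {v′} v∈U v′∈U v≢v′ b G → cong (λ p → not (p ==ᵛ τ))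
        (profile-switchCandidate-other v∈U b G v′∈U (≢⇒==ᶠ-false v′ v (λ v′≡v → v≢v′ (sym v′≡v)))))
      (λ v∈U G has → ≤-reflexive (trans
        (∑-cong (bitVectors #subsets) (λ b → cong (λ p → ⟦ not (p ==ᵛ τ) ⟧) (profile-switchCandidate v∈U G has b)))
        (∑-xorᵛ-≢ (profile G _) τ)))

  ⟦not-hasWitnesses⟧≤ : ∀ G → ⟦ not (hasWitnesses G) ⟧ ≤ ∑ (allFin #subsets) (λ j → ⟦ lacksWitness j G ⟧)
  ⟦not-hasWitnesses⟧≤ G = ≤-trans (⟦not-allᵇ⟧≤ _ (allFin #subsets)) (∑-mono (allFin #subsets) noWitness)
    where
    noWitness : ∀ j → ⟦ not (is-just (witness G j)) ⟧ ≤ ⟦ lacksWitness j G ⟧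
    noWitness j with witness G j in eq
    ... | just _  = z≤n
    ... | nothing = ≤-reflexive (cong ⟦_⟧ (sym (findᵇ-nothing _ W eq)))

  module _ (S-injective : ∀ i j → lookup S i ≡ lookup S j → i ≡ j) where

    selectedInS : Vec Bool k → Fin n → Bool
    selectedInS b x = isOdd (∑ (allFin k) (λ i → ⟦ lookup b i ∧ x ==ᶠ lookup S i ⟧))

    switchWitness : Fin n → Vec Bool k → Graph n → Graph n
    switchWitness y b G = toggleStar G y (selectedInS b)

    selectedInS-lookup : ∀ b i → selectedInS b (lookup S i) ≡ lookup b i
    selectedInS-lookup b i = begin
      isOdd (∑ (allFin k) (λ i′ → ⟦ lookup b i′ ∧ lookup S i ==ᶠ lookup S i′ ⟧))
        ≡⟨ cong isOdd (∑-cong (allFin k) (λ i′ → trans (cong ⟦_⟧ (trans (cong (lookup b i′ ∧_) (S-== i i′)) (∧-comm (lookup b i′) (i′ ==ᶠ i))))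
                                                         (⟦∧⟧ (i′ ==ᶠ i) _))) ⟩
      isOdd (∑ (allFin k) (λ i′ → ⟦ i′ ==ᶠ i ⟧ * ⟦ lookup b i′ ⟧))
        ≡⟨ cong isOdd (∑-Kronecker (enumFin k) i (λ i′ → ⟦ lookup b i′ ⟧)) ⟩
      isOdd ⟦ lookup b i ⟧
        ≡⟨ isOdd-⟦⟧ (lookup b i) ⟩
      lookup b i ∎
      where
      open ≡-Reasoning
      S-== : ∀ i i′ → lookup S i ==ᶠ lookup S i′ ≡ i′ ==ᶠ i
      S-== i i′ with i′ ==ᶠ i in eq
      ... | true  = subst (λ x → lookup S i ==ᶠ lookup S x ≡ true) (sym (==ᶠ⇒≡ eq)) (==ᶠ-refl (lookup S i))
      ... | false = ≢⇒==ᶠ-false (lookup S i) (lookup S i′) (λ Si≡Si′ → ==ᶠ-false⇒≢ eq (sym (S-injective i i′ Si≡Si′)))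

    nbrIn-switchWitness : ∀ {y} → y ∈ᵇ S ≡ false → ∀ b G → nbrIn (switchWitness y b G) y ≡ nbrIn G y xorᵛ b
    nbrIn-switchWitness {y} y∉S b G = lookup-ext _ _ λ i → begin
      lookup (nbrIn (switchWitness y b G) y) i                  ≡⟨ lookup-map i _ S ⟩
      adj (switchWitness y b G) y (lookup S i)                  ≡⟨ adj-toggleStar G y (selectedInS b) y (lookup S i) ⟩
      adj G y (lookup S i) xor star y (selectedInS b) y (lookup S i) ≡⟨ cong (adj G y (lookup S i) xor_) (star-S i) ⟩
      adj G y (lookup S i) xor lookup b i                       ≡⟨ cong (_xor lookup b i) (lookup-map i _ S) ⟨
      lookup (nbrIn G y) i xor lookup b i                       ≡⟨ lookup-zipWith _xor_ i (nbrIn G y) b ⟨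
      lookup (nbrIn G y xorᵛ b) i                               ∎
      where
      open ≡-Reasoning
      star-S : ∀ i → star y (selectedInS b) y (lookup S i) ≡ lookup b i
      star-S i rewrite ==ᶠ-refl y | trans (==ᶠ-sym (lookup S i) y) (∉ᵇ⇒==ᶠ-false S y∉S i) =
        trans (xor-identityʳ _) (selectedInS-lookup b i)

    lacksWitness-bound : ∀ j → RatioBound (∑ allGraphs (λ G → ⟦ lacksWitness j G ⟧)) (∑ allGraphs (λ _ → 1)) (2 ^ k ∸ 1) (length W)
    lacksWitness-bound j =
      Switching.iterated-switching-bound (enumGraph n) (enumVec enumBool k)
        (trans (length-enumVec enumBool k) (sym (1+[2^m∸1]≡2^m k)))
        switchWitness (λ y G → not (nbrIn G y ==ᵛ subset j)) (λ _ → true)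
        W W-unique
        (λ _ b G → toggleStar-involutive G _ (selectedInS b) (selectedInS b) (λ _ → refl))
        (λ _ _ _ → refl)
        (λ {y} {y′} y∈W _ y≢y′ b G → cong (λ p → not (p ==ᵛ subset j))
          (nbrIn-toggleStar G y (selectedInS b) y′ (≢⇒==ᶠ-false y′ y (λ y′≡y → y≢y′ (sym y′≡y))) (W∉S y∈W)))
        (λ y∈W G _ → ≤-reflexive (trans
          (∑-cong (bitVectors k) (λ b → cong (λ p → ⟦ not (p ==ᵛ subset j) ⟧) (nbrIn-switchWitness (W∉S y∈W) b G)))
          (∑-xorᵛ-≢ (nbrIn G _) (subset j))))

-- Counting bad graphs

∑-toℕ<ᵇ : ∀ n H → H ≤ n → ∑ (allFin n) (λ y → ⟦ toℕ y <ᵇ H ⟧) ≡ H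
∑-toℕ<ᵇ zero    zero    _       = refl
∑-toℕ<ᵇ (suc n) zero    _       = trans (∑-allFin-suc n (λ y → ⟦ toℕ y <ᵇ 0 ⟧)) (∑-const (allFin n) 0)
∑-toℕ<ᵇ (suc n) (suc H) (s≤s H≤n) = trans (∑-allFin-suc n (λ y → ⟦ toℕ y <ᵇ suc H ⟧)) (cong suc (∑-toℕ<ᵇ n H H≤n))

length-allFin : ∀ n → length (allFin n) ≡ n
length-allFin n = length-tabulate (λ i → i)

∑-not-toℕ<ᵇ : ∀ n H → H ≤ n → ∑ (allFin n) (λ y → ⟦ not (toℕ y <ᵇ H) ⟧) ≡ n ∸ H
∑-not-toℕ<ᵇ n H H≤n = begin
  ∑ (allFin n) (λ y → ⟦ not (low y) ⟧)
    ≡⟨ sym (m+n∸n≡m _ H) ⟩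
  ∑ (allFin n) (λ y → ⟦ not (low y) ⟧) + H ∸ H
    ≡⟨ cong (λ z → ∑ (allFin n) (λ y → ⟦ not (low y) ⟧) + z ∸ H) (sym (∑-toℕ<ᵇ n H H≤n)) ⟩
  ∑ (allFin n) (λ y → ⟦ not (low y) ⟧) + ∑ (allFin n) (λ y → ⟦ low y ⟧) ∸ H
    ≡⟨ cong (_∸ H) (sym (∑-+ (allFin n) _ _)) ⟩
  ∑ (allFin n) (λ y → ⟦ not (low y) ⟧ + ⟦ low y ⟧) ∸ H
    ≡⟨ cong (_∸ H) (∑-cong (allFin n) (λ y → trans (+-comm ⟦ not (low y) ⟧ _) (⟦⟧+⟦not⟧ (low y)))) ⟩
  ∑ (allFin n) (λ _ → 1) ∸ H
    ≡⟨ cong (_∸ H) (trans (sym (length≡∑1 (allFin n))) (length-allFin n)) ⟩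
  n ∸ H ∎
  where
  open ≡-Reasoning
  low : Fin n → Bool
  low y = toℕ y <ᵇ H

∑≤length-filter-∉ᵇ+ : ∀ {n k} (S : Vec (Fin n) k) (P : Fin n → Bool) →
                      ∑ (allFin n) (λ y → ⟦ P y ⟧) ≤ length (filterᵇ (λ y → not (y ∈ᵇ S) ∧ P y) (allFin n)) + k
∑≤length-filter-∉ᵇ+ {n} {k} S P = begin
  ∑ (allFin n) (λ y → ⟦ P y ⟧)
    ≤⟨ ∑-mono (allFin n) split ⟩
  ∑ (allFin n) (λ y → ⟦ not (y ∈ᵇ S) ∧ P y ⟧ + ⟦ y ∈ᵇ S ⟧)
    ≡⟨ ∑-+ (allFin n) _ _ ⟩
  ∑ (allFin n) (λ y → ⟦ not (y ∈ᵇ S) ∧ P y ⟧) + ∑ (allFin n) (λ y → ⟦ y ∈ᵇ S ⟧)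
    ≤⟨ +-mono-≤ (≤-reflexive (sym (length-filterᵇ _ (allFin n)))) (∑-∈ᵇ≤ S) ⟩
  length (filterᵇ (λ y → not (y ∈ᵇ S) ∧ P y) (allFin n)) + k ∎
  where
  open ≤-Reasoning
  split : ∀ y → ⟦ P y ⟧ ≤ ⟦ not (y ∈ᵇ S) ∧ P y ⟧ + ⟦ y ∈ᵇ S ⟧
  split y with y ∈ᵇ S
  ... | true  = ⟦⟧≤1 (P y)
  ... | false = m≤m+n _ 0

injectiveᵇ : ∀ {n k} → Vec (Fin n) k → Bool
injectiveᵇ {k = k} S = allᵇ (λ i → allᵇ (λ j → not (lookup S i ==ᶠ lookup S j) ∨ i ==ᶠ j) (allFin k)) (allFin k)

injectiveᵇ⇒injective : ∀ {n k} (S : Vec (Fin n) k) → injectiveᵇ S ≡ true → ∀ i j → lookup S i ≡ lookup S j → i ≡ j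
injectiveᵇ⇒injective {k = k} S inj i j Si≡Sj = ==ᶠ⇒≡ (trans (sym (cong (λ b → not b ∨ i ==ᶠ j) Si==Sj)) pair)
  where
  pair : not (lookup S i ==ᶠ lookup S j) ∨ i ==ᶠ j ≡ true
  pair = allᵇ⇒ _ (allᵇ⇒ _ inj (∈-elements (enumFin k) i)) (∈-elements (enumFin k) j)
  Si==Sj : lookup S i ==ᶠ lookup S j ≡ true
  Si==Sj = subst (λ x → lookup S i ==ᶠ x ≡ true) Si≡Sj (==ᶠ-refl (lookup S i))

injective⇒injectiveᵇ : ∀ {n k} (S : Vec (Fin n) k) → (∀ i j → lookup S i ≡ lookup S j → i ≡ j) → injectiveᵇ S ≡ true
injective⇒injectiveᵇ {k = k} S inj = ⇒allᵇ _ (allFin k) λ i → ⇒allᵇ _ (allFin k) λ j → pair i j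
  where
  pair : ∀ i j → not (lookup S i ==ᶠ lookup S j) ∨ i ==ᶠ j ≡ true
  pair i j with i ==ᶠ j in eq
  ... | true  = ∨-zeroʳ _
  ... | false = cong (λ b → not b ∨ false)
                     (≢⇒==ᶠ-false (lookup S i) (lookup S j) (λ Si≡Sj → ==ᶠ-false⇒≢ eq (inj i j Si≡Sj)))

module Counting (n k t : ℕ) where

  open SizedSubsets k (t ∸ 1) using (#subsets; subset; subset-surjective)

  low : Fin n → Bool
  low y = toℕ y <ᵇ ⌊ n /2⌋

  verticesOutside : Vec (Fin n) k → (Fin n → Bool) → List (Fin n)
  verticesOutside S P = filterᵇ (λ y → not (y ∈ᵇ S) ∧ P y) (allFin n)

  candidates witnessPool : Vec (Fin n) k → List (Fin n)
  candidates  S = verticesOutside S low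
  witnessPool S = verticesOutside S (λ y → not (low y))

  ∈-verticesOutside⁻ : ∀ S P {y} → y ∈ verticesOutside S P → y ∈ᵇ S ≡ false × P y ≡ true
  ∈-verticesOutside⁻ S P {y} y∈ with y ∈ᵇ S | P y | proj₂ (∈-filter⁻ (λ y → T? (not (y ∈ᵇ S) ∧ P y)) {xs = allFin n} y∈)
  ... | false | true | _ = refl , refl

  candidates∉witnessPool : ∀ {S u} → u ∈ candidates S → u ∉ witnessPool S
  candidates∉witnessPool {S} {u} u∈U u∈W
    with low u | proj₂ (∈-verticesOutside⁻ S low u∈U) | proj₂ (∈-verticesOutside⁻ S (λ y → not (low y)) u∈W)
  ... | true  | _  | ()
  ... | false | () | _

  module Ext (S : Vec (Fin n) k) =
    Extension S (t ∸ 1) (candidates S) (witnessPool S)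
      (Unique.filter⁺ _ (allFin⁺ n)) (Unique.filter⁺ _ (allFin⁺ n))
      (λ u∈ → proj₁ (∈-verticesOutside⁻ S low u∈)) (λ w∈ → proj₁ (∈-verticesOutside⁻ S _ w∈)) (candidates∉witnessPool {S})

  h : ℕ
  h = halfExponent n k

  h≤length-candidates : ∀ S → h ≤ length (candidates S)
  h≤length-candidates S = begin
    ⌊ n /2⌋ ∸ k                                        ≡⟨ cong (_∸ k) (sym (∑-toℕ<ᵇ n ⌊ n /2⌋ (⌊n/2⌋≤n n))) ⟩
    ∑ (allFin n) (λ y → ⟦ low y ⟧) ∸ k                 ≤⟨ ∸-monoˡ-≤ k (∑≤length-filter-∉ᵇ+ S low) ⟩
    length (candidates S) + k ∸ k                      ≡⟨ m+n∸n≡m _ k ⟩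
    length (candidates S)                              ∎
    where open ≤-Reasoning

  h≤length-witnessPool : ∀ S → h ≤ length (witnessPool S)
  h≤length-witnessPool S = begin
    ⌊ n /2⌋ ∸ k                                        ≤⟨ ∸-monoˡ-≤ k (m+n≤o⇒m≤o∸n ⌊ n /2⌋ (⌊n/2⌋+⌊n/2⌋≤n n)) ⟩
    n ∸ ⌊ n /2⌋ ∸ k                                    ≡⟨ cong (_∸ k) (sym (∑-not-toℕ<ᵇ n ⌊ n /2⌋ (⌊n/2⌋≤n n))) ⟩
    ∑ (allFin n) (λ y → ⟦ not (low y) ⟧) ∸ k           ≤⟨ ∸-monoˡ-≤ k (∑≤length-filter-∉ᵇ+ S (λ y → not (low y))) ⟩
    length (witnessPool S) + k ∸ k                     ≡⟨ m+n∸n≡m _ k ⟩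
    length (witnessPool S)                             ∎
    where open ≤-Reasoning

  R : ℕ
  R = 2 ^ (#subsets + k)

  RatioBound-halfExponent : ∀ {X Y e w} → e ≤ #subsets + k → h ≤ w → RatioBound X Y (2 ^ e ∸ 1) w → RatioBound X Y (suc R) h
  RatioBound-halfExponent {e = e} {w} e≤ h≤w bound = RatioBound-antimono-exponent h≤w (RatioBound-mono-base w base≤ bound)
    where
    base≤ : 2 ^ e ∸ 1 ≤ suc R
    base≤ = ≤-trans (m∸n≤m (2 ^ e) 1) (≤-trans (^-monoʳ-≤ 2 e≤) (n≤1+n R))

  allGraphs : List (Graph n)
  allGraphs = elements (enumGraph n)

  ∑-allGraphs-1 : ∑ allGraphs (λ _ → 1) ≡ 2 ^ (n C 2)
  ∑-allGraphs-1 = trans (sym (length≡∑1 allGraphs)) (length-enumGraph n)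

  missesTarget : Vec (Fin n) k → Vec Bool #subsets → Graph n → Bool
  missesTarget S τ G = allᵇ (λ v → not (Ext.profile S G v ==ᵛ τ)) (candidates S)

  badFor : Vec (Fin n) k → Vec Bool #subsets → Graph n → Bool
  badFor S τ G = injectiveᵇ S ∧ missesTarget S τ G

  badFor-bound : ∀ S τ → RatioBound (∑ allGraphs (λ G → ⟦ badFor S τ G ⟧)) (suc #subsets * 2 ^ (n C 2)) (suc R) h
  badFor-bound S τ with injectiveᵇ S in inj
  ... | false = RatioBound-mono (≤-reflexive (∑-const allGraphs 0)) ≤-refl RatioBound-zero
  ... | true  = RatioBound-mono (≤-trans (∑-mono allGraphs split) (≤-reflexive (∑-+ allGraphs _ _))) ≤-refl
                                (RatioBound-+ candidatesPart witnessPart)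
    where
    open Ext S
    split : ∀ G → ⟦ missesTarget S τ G ⟧ ≤ ⟦ hasWitnesses G ∧ missesTarget S τ G ⟧ + ⟦ not (hasWitnesses G) ⟧
    split G with hasWitnesses G
    ... | true  = m≤m+n _ 0
    ... | false = ⟦⟧≤1 (missesTarget S τ G)
    candidatesPart : RatioBound (∑ allGraphs (λ G → ⟦ hasWitnesses G ∧ missesTarget S τ G ⟧)) (2 ^ (n C 2)) (suc R) h
    candidatesPart = RatioBound-mono ≤-refl (≤-trans (∑-mono allGraphs (λ G → ⟦⟧≤1 (hasWitnesses G))) (≤-reflexive ∑-allGraphs-1))
      (RatioBound-halfExponent (m≤m+n #subsets k) (h≤length-candidates S) (candidates-bound τ))
    witnessPart : RatioBound (∑ allGraphs (λ G → ⟦ not (hasWitnesses G) ⟧)) (#subsets * 2 ^ (n C 2)) (suc R) h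
    witnessPart = RatioBound-mono
      (≤-trans (∑-mono allGraphs ⟦not-hasWitnesses⟧≤) (≤-reflexive (∑-comm allGraphs (allFin #subsets) _)))
      (≤-reflexive (trans (∑-cong (allFin #subsets) (λ _ → ∑-allGraphs-1))
                          (trans (∑-const (allFin #subsets) _)
                                 (trans (*-comm (2 ^ (n C 2)) _) (cong (_* 2 ^ (n C 2)) (length-allFin #subsets))))))
      (RatioBound-∑ (allFin #subsets) λ j →
        RatioBound-halfExponent (m≤n+m k #subsets) (h≤length-witnessPool S)
          (lacksWitness-bound (injectiveᵇ⇒injective S inj) j))

  tuples : List (Vec (Fin n) k)
  tuples = elements (enumVec (enumFin n) k)

  bad : Graph n → Bool
  bad G = any (λ S → any (λ τ → badFor S τ G) (bitVectors #subsets)) tuples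

  badGraphs : List (Graph n)
  badGraphs = filterᵇ bad allGraphs

  badGraphs-bound : RatioBound (length badGraphs) (n ^ k * (2 ^ #subsets * suc #subsets) * 2 ^ (n C 2)) (suc R) h
  badGraphs-bound = RatioBound-mono unionBound (≤-reflexive count)
    (RatioBound-∑ tuples λ S → RatioBound-∑ (bitVectors #subsets) λ τ → badFor-bound S τ)
    where
    unionBound : length badGraphs ≤ ∑ tuples (λ S → ∑ (bitVectors #subsets) (λ τ → ∑ allGraphs (λ G → ⟦ badFor S τ G ⟧)))
    unionBound = begin
      length badGraphs
        ≡⟨ length-filterᵇ bad allGraphs ⟩
      ∑ allGraphs (λ G → ⟦ bad G ⟧)
        ≤⟨ ∑-mono allGraphs (λ G → ≤-trans (⟦any⟧≤ _ tuples) (∑-mono tuples (λ S → ⟦any⟧≤ _ (bitVectors #subsets)))) ⟩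
      ∑ allGraphs (λ G → ∑ tuples (λ S → ∑ (bitVectors #subsets) (λ τ → ⟦ badFor S τ G ⟧)))
        ≡⟨ trans (∑-comm allGraphs tuples _) (∑-cong tuples (λ S → ∑-comm allGraphs (bitVectors #subsets) _)) ⟩
      ∑ tuples (λ S → ∑ (bitVectors #subsets) (λ τ → ∑ allGraphs (λ G → ⟦ badFor S τ G ⟧))) ∎
      where open ≤-Reasoning
    count : ∑ tuples (λ S → ∑ (bitVectors #subsets) (λ τ → suc #subsets * 2 ^ (n C 2)))
            ≡ n ^ k * (2 ^ #subsets * suc #subsets) * 2 ^ (n C 2)
    count = begin
      ∑ tuples (λ S → ∑ (bitVectors #subsets) (λ τ → suc #subsets * 2 ^ (n C 2)))
        ≡⟨ ∑-cong tuples (λ S → ∑-const (bitVectors #subsets) _) ⟩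
      ∑ tuples (λ S → suc #subsets * 2 ^ (n C 2) * length (bitVectors #subsets))
        ≡⟨ ∑-const tuples _ ⟩
      suc #subsets * 2 ^ (n C 2) * length (bitVectors #subsets) * length tuples
        ≡⟨ cong₂ (λ a b → suc #subsets * 2 ^ (n C 2) * a * b) (length-enumVec enumBool #subsets)
                 (trans (length-enumVec (enumFin n) k) (cong (_^ k) (length-allFin n))) ⟩
      suc #subsets * 2 ^ (n C 2) * 2 ^ #subsets * n ^ k
        ≡⟨ regroup (suc #subsets) (2 ^ (n C 2)) (2 ^ #subsets) (n ^ k) ⟩
      n ^ k * (2 ^ #subsets * suc #subsets) * 2 ^ (n C 2) ∎
      where
      open ≡-Reasoning
      regroup : ∀ a b c d → a * b * c * d ≡ d * (c * a) * b
      regroup = solve-∀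

  EA-unless-bad : 1 ≤ t → ∀ G → bad G ≡ false → EA t k G
  EA-unless-bad 1≤t G notBad S S-injective T = v , (λ i Si≡v → v≢S i (sym Si≡v)) , hyperedge
    where
    open Ext S
    τ : Vec Bool #subsets
    τ = tabulate (λ j → T (subset j))
    misses≡false : missesTarget S τ G ≡ false
    misses≡false = trans (cong (_∧ missesTarget S τ G) (sym (injective⇒injectiveᵇ S S-injective)))
      (any-false _ (any-false _ notBad (∈-elements (enumVec (enumFin n) k) S)) (∈-elements (enumVec enumBool #subsets) τ))
    found = allᵇ-false _ (candidates S) misses≡false
    v = proj₁ found
    v∉S : v ∈ᵇ S ≡ false
    v∉S = proj₁ (∈-verticesOutside⁻ S low (proj₁ (proj₂ found)))
    v≢S : ∀ i → v ≢ lookup S i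
    v≢S i = ==ᶠ-false⇒≢ (∉ᵇ⇒==ᶠ-false S v∉S i)
    profile≡τ : profile G v ≡ τ
    profile≡τ = ==⇒≡ (enumVec enumBool #subsets) (trans (sym (not-involutive _)) (cong not (proj₂ (proj₂ found))))
    parity : ∀ σ → ∣ σ ∣ ≡ t ∸ 1 → isOdd (commonNbrs G (v ∷ pick S σ)) ≡ T σ
    parity σ ∣σ∣≡ with subset-surjective σ ∣σ∣≡
    ... | j , refl = trans (sym (lookup∘tabulate _ j)) (trans (cong (λ p → lookup p j) profile≡τ) (lookup∘tabulate _ j))
    hyperedge : ∀ σ → ∣ σ ∣ ≡ t ∸ 1 → Hyperedge t G (v ∷ pick S σ) ⇔ (T σ ≡ true)
    hyperedge σ ∣σ∣≡ = mk⇔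
      (λ (_ , _ , odd) → trans (sym (parity σ ∣σ∣≡)) (%2≡1⇒isOdd (commonNbrs G (v ∷ pick S σ)) odd))
      (λ Tσ → (All-pick S σ v≢S ∷ pick-unique S σ S-injective)
            , trans (cong suc (trans (length-pick S σ) ∣σ∣≡)) (m+[n∸m]≡n 1≤t)
            , isOdd⇒%2≡1 (commonNbrs G (v ∷ pick S σ)) (trans (parity σ ∣σ∣≡) Tσ))

  ¬EA⇒∈badGraphs : 1 ≤ t → ∀ G → ¬ EA t k G → G ∈ badGraphs
  ¬EA⇒∈badGraphs 1≤t G ¬EA with bad G in isBad
  ... | true  = ∈-filter⁺ (λ G → T? (bad G)) (∈-elements (enumGraph n) G) (subst T (sym isBad) _)
  ... | false = ⊥-elim (¬EA (EA-unless-bad 1≤t G isBad))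

  failProbAtMost : 1 ≤ t → ∀ q → n ^ k * (2 ^ #subsets * suc #subsets) * q * suc R ^ h ≤ suc (suc R) ^ h →
                   FailProbAtMost n (EA t k) q
  failProbAtMost 1≤t q small = badGraphs , ¬EA⇒∈badGraphs 1≤t ,
    RatioBound⇒*≤ {length badGraphs} {n ^ k * (2 ^ #subsets * suc #subsets)} {2 ^ (n C 2)} {suc R} {h} q badGraphs-bound small

lemma6 : ∀ (k t : ℕ) → 1 ≤ k → 1 ≤ t →
         ∀ (p : List ℕ) → ∃[ N ] (∀ n → N ≤ n →
           FailProbAtMost n (EA t k) (evalPoly p n))
lemma6 k t _ 1≤t p =
  let m = SizedSubsets.#subsets k (t ∸ 1)
      (N , small) = polynomial*r^halfExponent≤ (2 ^ (m + k)) k (2 ^ m * suc m) p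
  in N , λ n N≤n → Counting.failProbAtMost n k t 1≤t (evalPoly p n) (small n N≤n)
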